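{- Let $q\equiv 1\pmod 4$ be a prime power, let $(a,b)\in V(\mathbb{F}_q)$ and $\lambda=b^2/a^2$. Then: (1) $(a,b)$ has a parent in $A(\mathbb{F}_q)$ if and only if $E_\lambda[4]\subseteq E_\lambda(\mathbb{F}_q)$. (2) If $(a,b)$ has no parent in $A(\mathbb{F}_q)$, then $(0,0)\in 4E_\lambda(\mathbb{F}_q)$ if and only if $(a,b)$ has a child in $A(\mathbb{F}_q)$.
   Context: $V(\mathbb{F}_q)=\{(a,b)\in\mathbb{F}_q^2: a\neq 0,\ b\neq 0,\ a\neq \pm b\}$. For $(a,b)\in V(\mathbb{F}_q)$: if $ab$ is a square in $\mathbb{F}_q^\times$, $\mathrm{AGM}(a,b)=\{(\tfrac{a+b}{2},s),(\tfrac{a+b}{2},-s)\}$ with $s^2=ab$; otherwise $\mathrm{AGM}(a,b)=\varnothing$. The aquarium $A(\mathbb{F}_q)$ is the directed graph on $V(\mathbb{F}_q)$ with an edge $(a,b)\to(a',b')$ iff $(a',b')\in\mathrm{AGM}(a,b)$; then $(a',b')$ is a child of $(a,b)$ and $(a,b)$ a parent of $(a',b')$. $E_\lambda: y^2=x(x-1)(x-\lambda)$; $E_\lambda[4]$ is the full $4$-torsion over $\overline{\mathbb{F}}_q$, and $4E_\lambda(\mathbb{F}_q)=\{4R: R\in E_\lambda(\mathbb{F}_q)\}$. -}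

module Defs where

open import Level using (Level; 0ℓ) renaming (suc to lsuc; _⊔_ to _⊔ˡ_)
open import Data.Nat as ℕ using (ℕ; _^_; _≥_)
open import Data.Nat.DivMod using (_%_)
open import Data.Nat.Primality using (Prime)
open import Data.Fin using (Fin)
open import Data.Product using (Σ; ∃; _×_; _,_)
open import Data.Sum using (_⊎_)
open import Relation.Nullary using (¬_; yes; no)
open import Relation.Binary using (Decidable)
open import Relation.Binary.PropositionalEquality using (_≡_)
open import Algebra.Bundles using (CommutativeRing)
open import Algebra.Morphism.Structures using (module RingMorphisms)

-- We also require
-- decidable equality (needed to compute the chord–tangent group law).

record Field (c ℓ : Level) : Set (lsuc (c ⊔ˡ ℓ)) where
  field
    commutativeRing : CommutativeRing c ℓ
  open CommutativeRing commutativeRing public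
  infix 8 _⁻¹
  field
    _⁻¹        : Carrier → Carrier          -- value at 0 is irrelevant
    0≉1        : ¬ (0# ≈ 1#)
    ⁻¹-inverse : ∀ x → ¬ (x ≈ 0#) → (x * x ⁻¹) ≈ 1#
    _≟_        : Decidable _≈_

  infixl 7 _/_
  _/_ : Carrier → Carrier → Carrier
  x / y = x * y ⁻¹

  2# : Carrier
  2# = 1# + 1#

  3# : Carrier
  3# = 1# + 1# + 1#

record HasCardinality {c ℓ} (F : Field c ℓ) (q : ℕ) : Set (c ⊔ˡ ℓ) where
  open Field F
  field
    enum       : Fin q → Carrier
    injective  : ∀ i j → enum i ≈ enum j → i ≡ j
    surjective : ∀ x → ∃ λ i → enum i ≈ x

IsPrimePower : ℕ → Set
IsPrimePower q = Σ ℕ λ p → Σ ℕ λ k → Prime p × k ≥ 1 × q ≡ p ^ k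

IsFieldHom : ∀ {c ℓ c' ℓ'} (F : Field c ℓ) (L : Field c' ℓ') →
             (Field.Carrier F → Field.Carrier L) → Set _
IsFieldHom F L ι = RingMorphisms.IsRingHomomorphism (Field.rawRing F) (Field.rawRing L) ι

module Aquarium {c ℓ} (F : Field c ℓ) where
  open Field F

  InV : Carrier → Carrier → Set ℓ
  InV a b = ¬ (a ≈ 0#) × ¬ (b ≈ 0#) × ¬ (a ≈ b) × ¬ (a ≈ - b)

  InAGM : Carrier → Carrier → Carrier → Carrier → Set (c ⊔ˡ ℓ)
  InAGM a b a' b' = Σ Carrier λ s → (s * s ≈ a * b) ×
                    (a' ≈ (a + b) / 2#) × (b' ≈ s ⊎ b' ≈ - s)

  Edge : Carrier → Carrier → Carrier → Carrier → Set (c ⊔ˡ ℓ)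
  Edge a b a' b' = InV a b × InV a' b' × InAGM a b a' b'

  HasParent : Carrier → Carrier → Set (c ⊔ˡ ℓ)
  HasParent a b = Σ Carrier λ a₀ → Σ Carrier λ b₀ → Edge a₀ b₀ a b

  HasChild : Carrier → Carrier → Set (c ⊔ˡ ℓ)
  HasChild a b = Σ Carrier λ a₁ → Σ Carrier λ b₁ → Edge a b a₁ b₁

-- The Legendre curve E_l : y² = x(x-1)(x-l) = x³ + a₂x² + a₄x,
-- a₂ = -(1+l), a₄ = l, with the chord–tangent group law.

data Pt {c} (A : Set c) : Set c where
  ∞     : Pt A
  ⟨_,_⟩ : A → A → Pt A

module Legendre {c ℓ} (K : Field c ℓ) (l : Field.Carrier K) where
  open Field K

  OnCurve : Pt Carrier → Set ℓ
  OnCurve ∞         = Level.Lift ℓ Data.Unit.⊤ where import Data.Unit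
  OnCurve ⟨ x , y ⟩ = (y * y) ≈ (x * (x - 1#) * (x - l))

  _≈P_ : Pt Carrier → Pt Carrier → Set ℓ
  ∞ ≈P ∞                     = Level.Lift ℓ Data.Unit.⊤ where import Data.Unit
  ⟨ x , y ⟩ ≈P ⟨ x' , y' ⟩ = (x ≈ x') × (y ≈ y')
  _ ≈P _                     = Level.Lift ℓ Data.Empty.⊥ where import Data.Empty

  a₂ a₄ : Carrier
  a₂ = - (1# + l)
  a₄ = l

  private
    chord : Carrier → Carrier → Carrier → Carrier → Pt Carrier
    chord m x₁ y₁ x₂ = ⟨ x₃ , - (y₁ + m * (x₃ - x₁)) ⟩
      where x₃ = m * m - a₂ - x₁ - x₂

  infixl 6 _⊕_
  _⊕_ : Pt Carrier → Pt Carrier → Pt Carrier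
  ∞ ⊕ Q = Q
  ⟨ x₁ , y₁ ⟩ ⊕ ∞ = ⟨ x₁ , y₁ ⟩
  ⟨ x₁ , y₁ ⟩ ⊕ ⟨ x₂ , y₂ ⟩ with x₁ ≟ x₂ | y₁ ≟ (- y₂)
  ... | yes _ | yes _ = ∞
  ... | yes _ | no  _ = chord ((3# * x₁ * x₁ + 2# * a₂ * x₁ + a₄) / (2# * y₁)) x₁ y₁ x₂
  ... | no  _ | _     = chord ((y₂ - y₁) / (x₂ - x₁)) x₁ y₁ x₂

  [4] : Pt Carrier → Pt Carrier
  [4] P = let P₂ = P ⊕ P in P₂ ⊕ P₂

  Origin∈4E : Set (c ⊔ˡ ℓ)
  Origin∈4E = Σ (Pt Carrier) λ R → OnCurve R × ([4] R ≈P ⟨ 0# , 0# ⟩)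

mapPt : ∀ {a b} {A : Set a} {B : Set b} → (A → B) → Pt A → Pt B
mapPt f ∞ = ∞
mapPt f ⟨ x , y ⟩ = ⟨ f x , f y ⟩

-- E_l[4] ⊆ E_l(F): every 4-torsion point of E_l over any field
-- extension ι : F → L (in particular over the algebraic closure) is the
-- image of an F-rational point.
FullFourTorsion : ∀ {c ℓ} (F : Field c ℓ) → Field.Carrier F → Set (lsuc (c ⊔ˡ ℓ))
FullFourTorsion {c} {ℓ} F l =
  (L : Field c ℓ) (ι : Field.Carrier F → Field.Carrier L) → IsFieldHom F L ι →
  (P : Pt (Field.Carrier L)) →
  Legendre.OnCurve L (ι l) P →
  Legendre._≈P_ L (ι l) (Legendre.[4] L (ι l) P) ∞ →
  Σ (Pt (Field.Carrier F)) λ Q → Legendre.OnCurve F l Q ×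
    Legendre._≈P_ L (ι l) (mapPt ι Q) P

module Submission where

open import Defs
open import Level using (0ℓ; _⊔_; lift; lower)
open import Algebra.Bundles using (CommutativeRing)
open import Algebra.Structures using (IsCommutativeRing)
open import Algebra.Morphism.Structures using (module RingMorphisms)
open import Data.Empty using (⊥; ⊥-elim)
open import Data.Unit using (tt)
open import Data.Nat as ℕ using (ℕ; zero; suc)
import Data.Nat.Properties as ℕ
open import Data.Nat.DivMod as ℕ using (_%_; m≡m%n+[m/n]*n)
open import Data.Integer as ℤ using (ℤ; +_; -[1+_]; _⊖_)
import Data.Integer.Properties as ℤ
open import Data.Sign as Sign using (Sign)
open import Data.Maybe using (Maybe; just; nothing)
open import Data.Product using (Σ; _×_; _,_; proj₁; proj₂)
open import Data.Sum as Sum using (_⊎_; inj₁; inj₂; [_,_]′)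
open import Data.List using (List; []; _∷_; length; foldr; filter; tabulate)
open import Data.List.Properties using (filter-all; length-tabulate)
open import Data.List.Relation.Unary.Any as Any using (here; there; any?; satisfied)
open import Data.List.Relation.Unary.All as All using (All)
open import Data.List.Relation.Unary.AllPairs using (_∷_)
open import Function using (id; _∘_; flip)
open import Function.Bundles using (_⇔_; mk⇔)
open import Relation.Binary.PropositionalEquality as ≡ using (_≡_; _≢_)
open import Relation.Nullary using (¬_; ¬?; Dec; yes; no; contradiction; _×-dec_)
open import Relation.Nullary.Decidable using (decidable-stable; map′)

-- Write l = t² with t = b/a. A parent of (a, b) exists iff a² - b², i.e. 1 - l, is a square,
-- and a child iff ab, i.e. t, is a square. On the curve side, a point P of order 4 doubles to
-- a 2-torsion point (e, 0), and the tangent at P through (e, 0) forces (x - e)² = f′(e), which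
-- is l, 1 - l or l(l - 1) for e = 0, 1, l. As -1 is a square when q ≡ 1 (mod 4), all of E[4]
-- is rational iff 1 - l is a square; over F(√(1 - l)) the half of (1, 0) with x = 1 + √(1 - l)
-- is a non-rational point of order 4. Likewise R with 4R = (0, 0) forces l = w⁴, hence t = ±w²,
-- and conversely the classical halving formula halves (0, 0) twice as soon as t, t - 1 (or -t,
-- -t - 1) are squares; without a parent one of t ± 1 is a square, because a product of two
-- non-squares is a square and -(t - 1)(t + 1) = 1 - l is not. Euler's criterion behind these
-- facts about squares comes from Wilson-style pairings x ↔ n/x of the nonzero elements.

module IntegerCoefficients {c ℓ} (R : CommutativeRing c ℓ) where
  open CommutativeRing R
  open import Algebra.Properties.Ring ring using (-‿involutive; -‿+-comm; -‿distribʳ-*; -1*x≈-x; -0#≈0#)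
  open import Algebra.Properties.Semiring.Mult.TCOptimised semiring using (×-homo-+; ×1-homo-*; 1+×) renaming (_×_ to _×′_)
  open import Algebra.Solver.Ring.AlmostCommutativeRing using (fromCommutativeRing; _-Raw-AlmostCommutative⟶_)
  open import Algebra.Properties.CommutativeSemigroup *-commutativeSemigroup using (interchange)
  open import Relation.Binary.Reasoning.Setoid setoid

  private
    -- With the type-checking optimised _×′_, the numerals 2 and 3 map to 1# + 1# and
    -- 1# + 1# + 1# on the nose, i.e. to Field.2# and Field.3#.
    fromℤ : ℤ → Carrier
    fromℤ (+ n)      = n ×′ 1#
    fromℤ -[1+ n ]   = - (suc n ×′ 1#)

    sign : Sign → Carrier
    sign Sign.+ = 1#
    sign Sign.- = - 1#

    sign-* : ∀ s t → sign (s Sign.* t) ≈ sign s * sign t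
    sign-* Sign.+ t       = sym (*-identityˡ _)
    sign-* Sign.- Sign.+  = sym (*-identityʳ _)
    sign-* Sign.- Sign.-  = begin
      1#            ≈⟨ -‿involutive 1# ⟨
      - - 1#        ≈⟨ -‿cong (-1*x≈-x 1#) ⟨
      - (- 1# * 1#) ≈⟨ -‿distribʳ-* (- 1#) 1# ⟩
      - 1# * - 1#   ∎

    ◃-homo : ∀ s n → fromℤ (s ℤ.◃ n) ≈ sign s * n ×′ 1#
    ◃-homo s       zero    = sym (zeroʳ _)
    ◃-homo Sign.+ (suc n) = sym (*-identityˡ _)
    ◃-homo Sign.- (suc n) = sym (-1*x≈-x _)

    sign-abs : ∀ i → fromℤ i ≈ sign (ℤ.sign i) * ℤ.∣ i ∣ ×′ 1#
    sign-abs i = trans (reflexive (≡.cong fromℤ (≡.sym (ℤ.◃-inverse i)))) (◃-homo (ℤ.sign i) ℤ.∣ i ∣)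

    ⊖-homo : ∀ m n → fromℤ (m ⊖ n) ≈ m ×′ 1# - n ×′ 1#
    ⊖-homo m zero rewrite ℤ.⊖-≥ (ℕ.z≤n {m}) = sym (trans (+-congˡ -0#≈0#) (+-identityʳ _))
    ⊖-homo zero (suc n) = sym (+-identityˡ _)
    ⊖-homo (suc m) (suc n) rewrite ℤ.[1+m]⊖[1+n]≡m⊖n m n = begin
      fromℤ (m ⊖ n)                      ≈⟨ ⊖-homo m n ⟩
      m ×′ 1# - n ×′ 1#                ≈⟨ 1+x-[1+y]≈x-y (m ×′ 1#) (n ×′ 1#) ⟨
      (1# + m ×′ 1#) - (1# + n ×′ 1#)  ≈⟨ +-cong (1+× m 1#) (-‿cong (1+× n 1#)) ⟨
      suc m ×′ 1# - suc n ×′ 1#        ∎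
      where
      1+x-[1+y]≈x-y : ∀ x y → (1# + x) - (1# + y) ≈ x - y
      1+x-[1+y]≈x-y x y = begin
        (1# + x) - (1# + y)       ≈⟨ +-cong (+-comm x 1#) (-‿+-comm 1# y) ⟨
        (x + 1#) + (- 1# + - y)   ≈⟨ +-assoc x 1# _ ⟩
        x + (1# + (- 1# + - y))   ≈⟨ +-congˡ (+-assoc 1# (- 1#) (- y)) ⟨
        x + ((1# - 1#) + - y)     ≈⟨ +-congˡ (+-congʳ (-‿inverseʳ 1#)) ⟩
        x + (0# + - y)            ≈⟨ +-congˡ (+-identityˡ (- y)) ⟩
        x - y                     ∎

    +-homo : ∀ i j → fromℤ (i ℤ.+ j) ≈ fromℤ i + fromℤ j
    +-homo (+ m)    (+ n)    = ×-homo-+ 1# m n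
    +-homo (+ m)    -[1+ n ] = ⊖-homo m (suc n)
    +-homo -[1+ m ] (+ n)    = trans (⊖-homo n (suc m)) (+-comm _ _)
    +-homo -[1+ m ] -[1+ n ] = begin
      - (suc (suc (m ℕ.+ n)) ×′ 1#)         ≡⟨ ≡.cong (λ k → - (k ×′ 1#)) (≡.cong suc (≡.sym (ℕ.+-suc m n))) ⟩
      - ((suc m ℕ.+ suc n) ×′ 1#)           ≈⟨ -‿cong (×-homo-+ 1# (suc m) (suc n)) ⟩
      - (suc m ×′ 1# + suc n ×′ 1#)          ≈⟨ -‿+-comm _ _ ⟨
      - (suc m ×′ 1#) + - (suc n ×′ 1#)      ∎

    *-homo : ∀ i j → fromℤ (i ℤ.* j) ≈ fromℤ i * fromℤ j
    *-homo i j = begin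
      fromℤ ((sᵢ Sign.* sⱼ) ℤ.◃ (nᵢ ℕ.* nⱼ))              ≈⟨ ◃-homo (sᵢ Sign.* sⱼ) (nᵢ ℕ.* nⱼ) ⟩
      sign (sᵢ Sign.* sⱼ) * (nᵢ ℕ.* nⱼ) ×′ 1#           ≈⟨ *-cong (sign-* sᵢ sⱼ) (×1-homo-* nᵢ nⱼ) ⟩
      (sign sᵢ * sign sⱼ) * (nᵢ ×′ 1# * nⱼ ×′ 1#)        ≈⟨ interchange _ _ _ _ ⟩
      (sign sᵢ * nᵢ ×′ 1#) * (sign sⱼ * nⱼ ×′ 1#)        ≈⟨ *-cong (sign-abs i) (sign-abs j) ⟨
      fromℤ i * fromℤ j                                    ∎
      where
      sᵢ = ℤ.sign i ; sⱼ = ℤ.sign j ; nᵢ = ℤ.∣ i ∣ ; nⱼ = ℤ.∣ j ∣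

    -‿homo : ∀ i → fromℤ (ℤ.- i) ≈ - fromℤ i
    -‿homo (+ zero)  = sym -0#≈0#
    -‿homo (+ suc n) = refl
    -‿homo -[1+ n ]  = sym (-‿involutive _)

    homomorphism : ℤ.+-*-rawRing -Raw-AlmostCommutative⟶ fromCommutativeRing R
    homomorphism = record
      { ⟦_⟧ = fromℤ ; +-homo = +-homo ; *-homo = *-homo ; -‿homo = -‿homo
      ; 0-homo = refl ; 1-homo = refl }

    equal? : ∀ i j → Maybe (fromℤ i ≈ fromℤ j)
    equal? i j with i ℤ.≟ j
    ... | yes ≡.refl = just refl
    ... | no _       = nothing

  open import Algebra.Solver.Ring ℤ.+-*-rawRing (fromCommutativeRing R) homomorphism equal? public


  κ : ∀ {m} → ℕ → Polynomial m
  κ n = con (+ n)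

module FieldProperties {c ℓ} (F : Field c ℓ) where
  open Field F
  open IntegerCoefficients commutativeRing public
  open import Algebra.Properties.Ring ring public using (-‿involutive; -0#≈0#)
  open import Algebra.Properties.Group +-group
    using () renaming (x∙y⁻¹≈ε⇒x≈y to x-y≈0⇒x≈y; x≈y⇒x∙y⁻¹≈ε to x≈y⇒x-y≈0) public
  open import Relation.Binary.Reasoning.Setoid setoid public

  IsSquare : Carrier → Set (c ⊔ ℓ)
  IsSquare x = Σ Carrier λ r → r * r ≈ x

  -- An identity p ≈ q modulo hypotheses aᵢ ≈ bᵢ is certified by writing p - q as
  -- Σ kᵢ * (aᵢ - bᵢ); the ring solver checks this polynomial identity.
  infixl 5 _∷ʳ_
  data Vanishing : Carrier → Set (c ⊔ ℓ) where
    [_]  : ∀ {k a b} → a ≈ b → Vanishing (k * (a - b))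
    _∷ʳ_ : ∀ {s k a b} → Vanishing s → a ≈ b → Vanishing (s + k * (a - b))

  vanishing⇒≈0 : ∀ {s} → Vanishing s → s ≈ 0#
  vanishing⇒≈0 ([_] {k} a≈b)      = trans (*-congˡ (x≈y⇒x-y≈0 a≈b)) (zeroʳ k)
  vanishing⇒≈0 (_∷ʳ_ {k = k} v a≈b) =
    trans (+-cong (vanishing⇒≈0 v) (trans (*-congˡ (x≈y⇒x-y≈0 a≈b)) (zeroʳ k))) (+-identityʳ 0#)

  by-combination : ∀ {p q s} → p - q ≈ s → Vanishing s → p ≈ q
  by-combination p-q≈s v = x-y≈0⇒x≈y _ _ (trans p-q≈s (vanishing⇒≈0 v))

  x*y≈0⇒x≈0⊎y≈0 : ∀ {x y} → x * y ≈ 0# → x ≈ 0# ⊎ y ≈ 0#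
  x*y≈0⇒x≈0⊎y≈0 {x} {y} xy≈0 with x ≟ 0#
  ... | yes x≈0 = inj₁ x≈0
  ... | no x≉0  = inj₂ (begin
    y                    ≈⟨ *-identityˡ y ⟨
    1# * y               ≈⟨ *-congʳ (trans (*-comm _ _) (⁻¹-inverse x x≉0)) ⟨
    (x ⁻¹ * x) * y       ≈⟨ *-assoc _ _ _ ⟩
    x ⁻¹ * (x * y)       ≈⟨ *-congˡ xy≈0 ⟩
    x ⁻¹ * 0#            ≈⟨ zeroʳ _ ⟩
    0#                   ∎)

  x≉0∧y≉0⇒x*y≉0 : ∀ {x y} → ¬ x ≈ 0# → ¬ y ≈ 0# → ¬ x * y ≈ 0#
  x≉0∧y≉0⇒x*y≉0 x≉0 y≉0 xy≈0 = [ x≉0 , y≉0 ]′ (x*y≈0⇒x≈0⊎y≈0 xy≈0)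

  x*x≈0⇒x≈0 : ∀ {x} → x * x ≈ 0# → x ≈ 0#
  x*x≈0⇒x≈0 xx≈0 = [ id , id ]′ (x*y≈0⇒x≈0⊎y≈0 xx≈0)

  *-cancelʳ : ∀ {x y z} → ¬ z ≈ 0# → x * z ≈ y * z → x ≈ y
  *-cancelʳ {x} {y} {z} z≉0 xz≈yz = begin
    x                ≈⟨ *-identityʳ x ⟨
    x * 1#           ≈⟨ *-congˡ (⁻¹-inverse z z≉0) ⟨
    x * (z * z ⁻¹)   ≈⟨ *-assoc x z _ ⟨
    (x * z) * z ⁻¹   ≈⟨ *-congʳ xz≈yz ⟩
    (y * z) * z ⁻¹   ≈⟨ *-assoc y z _ ⟩
    y * (z * z ⁻¹)   ≈⟨ *-congˡ (⁻¹-inverse z z≉0) ⟩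
    y * 1#           ≈⟨ *-identityʳ y ⟩
    y                ∎

  x/y*y≈x : ∀ {x y} → ¬ y ≈ 0# → (x / y) * y ≈ x
  x/y*y≈x {x} {y} y≉0 = begin
    (x * y ⁻¹) * y  ≈⟨ *-assoc x _ y ⟩
    x * (y ⁻¹ * y)  ≈⟨ *-congˡ (trans (*-comm _ _) (⁻¹-inverse y y≉0)) ⟩
    x * 1#          ≈⟨ *-identityʳ x ⟩
    x               ∎

  ⁻¹-cong : ∀ {x y} → ¬ x ≈ 0# → x ≈ y → x ⁻¹ ≈ y ⁻¹
  ⁻¹-cong {x} {y} x≉0 x≈y = *-cancelʳ x≉0 (begin
    x ⁻¹ * x  ≈⟨ trans (*-comm _ _) (⁻¹-inverse x x≉0) ⟩
    1#        ≈⟨ ⁻¹-inverse y (λ y≈0 → x≉0 (trans x≈y y≈0)) ⟨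
    y * y ⁻¹  ≈⟨ *-comm y _ ⟩
    y ⁻¹ * y  ≈⟨ *-congˡ x≈y ⟨
    y ⁻¹ * x  ∎)

  x*x≈y*y⇒x≈±y : ∀ {x y} → x * x ≈ y * y → x ≈ y ⊎ x ≈ - y
  x*x≈y*y⇒x≈±y {x} {y} xx≈yy =
    Sum.map (x-y≈0⇒x≈y _ _) (λ x+y≈0 → x-y≈0⇒x≈y _ _ (trans (+-congˡ (-‿involutive y)) x+y≈0))
      (x*y≈0⇒x≈0⊎y≈0 (by-combination
        (solve 2 (λ x y → (x :- y) :* (x :+ y) :- κ 0 := κ 1 :* (x :* x :- y :* y)) refl x y)
        [ xx≈yy ]))

  -x*-x≈x*x : ∀ x → - x * - x ≈ x * x
  -x*-x≈x*x = solve 1 (λ x → :- x :* :- x := x :* x) refl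

  x≈0⇒x≈-x : ∀ {x} → x ≈ 0# → x ≈ - x
  x≈0⇒x≈-x x≈0 = trans x≈0 (trans (sym -0#≈0#) (-‿cong (sym x≈0)))

  x≈-x⇒x≈0 : ¬ 2# ≈ 0# → ∀ {x} → x ≈ - x → x ≈ 0#
  x≈-x⇒x≈0 2≉0 {x} x≈-x = [ flip contradiction 2≉0 , id ]′ (x*y≈0⇒x≈0⊎y≈0 (by-combination
    (solve 1 (λ x → κ 2 :* x :- κ 0 := κ 1 :* (x :- :- x)) refl x)
    [ x≈-x ]))

  x-a≈b⇒x≈a+b : ∀ {x a b} → x - a ≈ b → x ≈ a + b
  x-a≈b⇒x≈a+b {x} {a} {b} x-a≈b = by-combination
    (solve 3 (λ x a b → x :- (a :+ b) := κ 1 :* ((x :- a) :- b)) refl x a b) [ x-a≈b ]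

  x-a≈-b⇒x≈a-b : ∀ {x a b} → x - a ≈ - b → x ≈ a - b
  x-a≈-b⇒x≈a-b {x} {a} {b} x-a≈-b = by-combination
    (solve 3 (λ x a b → x :- (a :- b) := κ 1 :* ((x :- a) :- :- b)) refl x a b) [ x-a≈-b ]

  x-a-cong : ∀ {x a b} → a ≈ b → x - a ≈ x - b
  x-a-cong a≈b = +-congˡ (-‿cong a≈b)

module LegendreCurve {c ℓ} (K : Field c ℓ) (l : Field.Carrier K) where
  open Field K
  open FieldProperties K
  open Legendre K l

  f : Carrier → Carrier
  f x = x * (x - 1#) * (x - l)

  -- f′, the numerator of the tangent slope in the addition law
  N : Carrier → Carrier
  N x = 3# * x * x + 2# * a₂ * x + a₄

  slope : Carrier → Carrier → Carrier
  slope x y = N x / (2# * y)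

  doubling : Carrier → Carrier → Carrier → Pt Carrier
  doubling m x y = ⟨ m * m - a₂ - x - x , - (y + m * ((m * m - a₂ - x - x) - x)) ⟩

  private
    fₚ : ∀ {n} → Polynomial n → Polynomial n → Polynomial n
    fₚ l x = x :* (x :- κ 1) :* (x :- l)

    Nₚ : ∀ {n} → Polynomial n → Polynomial n → Polynomial n
    Nₚ l x = κ 3 :* x :* x :+ κ 2 :* (:- (κ 1 :+ l)) :* x :+ l

    Xₚ : ∀ {n} → Polynomial n → Polynomial n → Polynomial n → Polynomial n
    Xₚ l m x = m :* m :- :- (κ 1 :+ l) :- x :- x

  f-cong : ∀ {x x'} → x ≈ x' → f x ≈ f x'
  f-cong x≈x' = *-cong (*-cong x≈x' (+-congʳ x≈x')) (+-congʳ x≈x')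

  N-cong : ∀ {x x'} → x ≈ x' → N x ≈ N x'
  N-cong x≈x' = +-congʳ (+-cong (*-cong (*-congˡ x≈x') x≈x') (*-congˡ x≈x'))

  f[0]≈0 : f 0# ≈ 0#
  f[0]≈0 = solve 1 (λ l → fₚ l (κ 0) := κ 0) refl l

  f[1]≈0 : f 1# ≈ 0#
  f[1]≈0 = solve 1 (λ l → fₚ l (κ 1) := κ 0) refl l

  f[l]≈0 : f l ≈ 0#
  f[l]≈0 = solve 1 (λ l → fₚ l l := κ 0) refl l

  N[0]≈l : N 0# ≈ l
  N[0]≈l = solve 1 (λ l → Nₚ l (κ 0) := l) refl l

  N[1]≈1-l : N 1# ≈ 1# - l
  N[1]≈1-l = solve 1 (λ l → Nₚ l (κ 1) := κ 1 :- l) refl l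

  N[l]≈l[l-1] : N l ≈ l * (l - 1#)
  N[l]≈l[l-1] = solve 1 (λ l → Nₚ l l := l :* (l :- κ 1)) refl l

  f≈0⇒root : ∀ {x} → f x ≈ 0# → x ≈ 0# ⊎ x ≈ 1# ⊎ x ≈ l
  f≈0⇒root fx≈0 with x*y≈0⇒x≈0⊎y≈0 fx≈0
  ... | inj₂ x-l≈0 = inj₂ (inj₂ (x-y≈0⇒x≈y _ _ x-l≈0))
  ... | inj₁ x[x-1]≈0 with x*y≈0⇒x≈0⊎y≈0 x[x-1]≈0
  ...   | inj₁ x≈0   = inj₁ x≈0
  ...   | inj₂ x-1≈0 = inj₂ (inj₁ (x-y≈0⇒x≈y _ _ x-1≈0))

  ≈P-trans : ∀ {P Q R} → P ≈P Q → Q ≈P R → P ≈P R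
  ≈P-trans {∞}         {∞}         {∞}         _ _ = lift tt
  ≈P-trans {⟨ _ , _ ⟩} {⟨ _ , _ ⟩} {⟨ _ , _ ⟩} (x≈x' , y≈y') (x'≈x'' , y'≈y'') =
    trans x≈x' x'≈x'' , trans y≈y' y'≈y''

  doubling-cong : ∀ {m m' x x' y y'} → m ≈ m' → x ≈ x' → y ≈ y' → doubling m x y ≈P doubling m' x' y'
  doubling-cong m≈m' x≈x' y≈y' = X≈X' , -‿cong (+-cong y≈y' (*-cong m≈m' (+-cong X≈X' (-‿cong x≈x'))))
    where X≈X' = +-cong (+-cong (+-congʳ (*-cong m≈m' m≈m')) (-‿cong x≈x')) (-‿cong x≈x')

  ⊕-self-vertical : ∀ {x y} → y ≈ - y → ⟨ x , y ⟩ ⊕ ⟨ x , y ⟩ ≡ ∞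
  ⊕-self-vertical {x} {y} y≈-y with x ≟ x | y ≟ (- y)
  ... | yes _ | yes _    = ≡.refl
  ... | yes _ | no y≉-y  = contradiction y≈-y y≉-y
  ... | no x≉x | _       = contradiction refl x≉x

  ⊕-self-tangent : ∀ {x y} → ¬ y ≈ - y → ⟨ x , y ⟩ ⊕ ⟨ x , y ⟩ ≡ doubling (slope x y) x y
  ⊕-self-tangent {x} {y} y≉-y with x ≟ x | y ≟ (- y)
  ... | yes _ | yes y≈-y = contradiction y≈-y y≉-y
  ... | yes _ | no _     = ≡.refl
  ... | no x≉x | _       = contradiction refl x≉x

  double≈∞⇒vertical : ∀ {x y} → (⟨ x , y ⟩ ⊕ ⟨ x , y ⟩) ≈P ∞ → y ≈ - y
  double≈∞⇒vertical {x} {y} 2P≈∞ = decidable-stable (y ≟ (- y)) λ y≉-y →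
    lower (≡.subst (_≈P ∞) (⊕-self-tangent {x} y≉-y) 2P≈∞)

  doubling-on-curve : ∀ {x y m} → y * y ≈ f x → m * (2# * y) ≈ N x → OnCurve (doubling m x y)
  doubling-on-curve {x} {y} {m} y²≈fx m2y≈Nx = by-combination
    (solve 4 (λ x y m l →
      let X = Xₚ l m x ; Y = :- (y :+ m :* (X :- x)) in
      Y :* Y :- fₚ l X := κ 1 :* (y :* y :- fₚ l x) :+ (X :- x) :* (m :* (κ 2 :* y) :- Nₚ l x))
      refl x y m l)
    ([ y²≈fx ] ∷ʳ m2y≈Nx)

  doubling-x-sub-root : ∀ {x y m e} → y * y ≈ f x → m * (2# * y) ≈ N x → f e ≈ 0# →
    (m * m - a₂ - x - x - e) * ((2# * y) * (2# * y)) ≈ ((x - e) * (x - e) - N e) * ((x - e) * (x - e) - N e)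
  doubling-x-sub-root {x} {y} {m} {e} y²≈fx m2y≈Nx fe≈0 = by-combination
    (solve 5 (λ x y m l e →
      let D = (x :- e) :* (x :- e) :- Nₚ l e in
      (Xₚ l m x :- e) :* ((κ 2 :* y) :* (κ 2 :* y)) :- D :* D
      := (m :* (κ 2 :* y) :+ Nₚ l x) :* (m :* (κ 2 :* y) :- Nₚ l x)
       :+ (:- (κ 4 :* (:- (κ 1 :+ l) :+ κ 2 :* x :+ e))) :* (y :* y :- fₚ l x)
       :+ (κ 4 :* (κ 1 :+ l :- κ 2 :* x :- e)) :* (fₚ l e :- κ 0))
      refl x y m l e)
    ([ m2y≈Nx ] ∷ʳ y²≈fx ∷ʳ fe≈0)

  half : Carrier → Carrier → Carrier → Pt Carrier
  half r₁ r₂ r₃ = ⟨ r₁ * r₁ + r₁ * r₂ + r₁ * r₃ + r₂ * r₃ , (r₁ + r₂) * (r₁ + r₃) * (r₂ + r₃) ⟩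

  factored-on-curve : ∀ {x A B C} → x ≈ A * B → x - 1# ≈ A * C → x - l ≈ B * C →
                      (A * B * C) * (A * B * C) ≈ f x
  factored-on-curve {x} {A} {B} {C} x≈AB x-1≈AC x-l≈BC = begin
    (A * B * C) * (A * B * C)      ≈⟨ solve 3 (λ A B C → (A :* B :* C) :* (A :* B :* C)
                                        := (A :* B) :* (A :* C) :* (B :* C)) refl A B C ⟩
    (A * B) * (A * C) * (B * C)    ≈⟨ *-cong (*-cong x≈AB x-1≈AC) x-l≈BC ⟨
    f x                            ∎

  factored-tangent : ∀ {x A B C} → x ≈ A * B → x - 1# ≈ A * C → x - l ≈ B * C →
                     (A + B + C) * (A * B * C) ≈ N x
  factored-tangent {x} {A} {B} {C} x≈AB x-1≈AC x-l≈BC = begin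
    (A + B + C) * (A * B * C)                          ≈⟨ solve 3 (λ A B C → (A :+ B :+ C) :* (A :* B :* C)
                                                            := (A :* C) :* (B :* C) :+ (A :* B) :* (B :* C) :+ (A :* B) :* (A :* C))
                                                            refl A B C ⟩
    (A * C) * (B * C) + (A * B) * (B * C) + (A * B) * (A * C)
      ≈⟨ +-cong (+-cong (*-cong x-1≈AC x-l≈BC) (*-cong x≈AB x-l≈BC)) (*-cong x≈AB x-1≈AC) ⟨
    (x - 1#) * (x - l) + x * (x - l) + x * (x - 1#)    ≈⟨ solve 2 (λ x l → (x :- κ 1) :* (x :- l) :+ x :* (x :- l) :+ x :* (x :- κ 1)
                                                            := Nₚ l x) refl x l ⟩
    N x                                                ∎

  -- The halves of a 2-torsion point (e, 0) have x = e ± r with r² = f′(e) = d; they are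
  -- rational when r and both y-coordinates exist in the field.
  record RationalHalves (e d : Carrier) : Set (c ⊔ ℓ) where
    field
      r           : Carrier
      r*r≈d       : r * r ≈ d
      y₊ y₋       : Carrier
      y₊-on-curve : y₊ * y₊ ≈ f (e + r)
      y₋-on-curve : y₋ * y₋ ≈ f (e - r)

  rational-halves : ∀ {t c i} → t * t ≈ l → c * c ≈ 1# - l → i * i ≈ - 1# →
                    RationalHalves 0# l × RationalHalves 1# (1# - l) × RationalHalves l (l * (l - 1#))
  rational-halves {t} {c} {i} t²≈l c²≈1-l i²≈-1 = over-0 , over-1 , over-l
    where
    over-0 : RationalHalves 0# l
    over-0 = record
      { r = t ; r*r≈d = t²≈l ; y₊ = t * i * (1# - t) ; y₋ = t * i * (1# + t)
      ; y₊-on-curve = by-combination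
          (solve 3 (λ t i l → (t :* i :* (κ 1 :- t)) :* (t :* i :* (κ 1 :- t)) :- fₚ l (κ 0 :+ t)
                    := (t :* t :* t :* t :- κ 2 :* t :* t :* t :+ t :* t) :* (i :* i :- :- κ 1)
                       :+ (:- (t :* t) :+ t) :* (t :* t :- l)) refl t i l)
          ([ i²≈-1 ] ∷ʳ t²≈l)
      ; y₋-on-curve = by-combination
          (solve 3 (λ t i l → (t :* i :* (κ 1 :+ t)) :* (t :* i :* (κ 1 :+ t)) :- fₚ l (κ 0 :- t)
                    := (t :* t :* t :* t :+ κ 2 :* t :* t :* t :+ t :* t) :* (i :* i :- :- κ 1)
                       :+ (:- (t :* t) :- t) :* (t :* t :- l)) refl t i l)
          ([ i²≈-1 ] ∷ʳ t²≈l)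
      }
    over-1 : RationalHalves 1# (1# - l)
    over-1 = record
      { r = c ; r*r≈d = c²≈1-l ; y₊ = c * (1# + c) ; y₋ = c * (1# - c)
      ; y₊-on-curve = by-combination
          (solve 2 (λ c l → (c :* (κ 1 :+ c)) :* (c :* (κ 1 :+ c)) :- fₚ l (κ 1 :+ c)
                    := (c :* c :+ c) :* (c :* c :- (κ 1 :- l))) refl c l)
          [ c²≈1-l ]
      ; y₋-on-curve = by-combination
          (solve 2 (λ c l → (c :* (κ 1 :- c)) :* (c :* (κ 1 :- c)) :- fₚ l (κ 1 :- c)
                    := (c :* c :- c) :* (c :* c :- (κ 1 :- l))) refl c l)
          [ c²≈1-l ]
      }
    -- Over e = l the factorisations l ± itc = t (t ± ic), l ± itc - 1 = ± ic (t ± ic) hold.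
    over-l : RationalHalves l (l * (l - 1#))
    over-l = record
      { r = i * t * c
      ; r*r≈d = by-combination
          (solve 4 (λ t c i l → (i :* t :* c) :* (i :* t :* c) :- l :* (l :- κ 1)
                    := (t :* t :* i :* i :+ t :* t :+ l :- κ 1) :* (t :* t :- l)
                       :+ t :* t :* i :* i :* (c :* c :- (κ 1 :- l))
                       :+ (:- (t :* t :* t :* t) :+ t :* t) :* (i :* i :- :- κ 1)) refl t c i l)
          ([ t²≈l ] ∷ʳ c²≈1-l ∷ʳ i²≈-1)
      ; y₊ = (t + i * c) * t * (i * c) ; y₋ = (t - i * c) * t * - (i * c)
      ; y₊-on-curve = factored-on-curve
          (by-combination (solve 4 (λ t c i l → l :+ i :* t :* c :- (t :+ i :* c) :* t := :- κ 1 :* (t :* t :- l)) refl t c i l)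
            [ t²≈l ])
          (by-combination (solve 4 (λ t c i l → (l :+ i :* t :* c :- κ 1) :- (t :+ i :* c) :* (i :* c)
                                               := κ 1 :* (c :* c :- (κ 1 :- l)) :+ :- (c :* c) :* (i :* i :- :- κ 1)) refl t c i l)
            ([ c²≈1-l ] ∷ʳ i²≈-1))
          (solve 4 (λ t c i l → l :+ i :* t :* c :- l := t :* (i :* c)) refl t c i l)
      ; y₋-on-curve = factored-on-curve
          (by-combination (solve 4 (λ t c i l → l :- i :* t :* c :- (t :- i :* c) :* t := :- κ 1 :* (t :* t :- l)) refl t c i l)
            [ t²≈l ])
          (by-combination (solve 4 (λ t c i l → (l :- i :* t :* c :- κ 1) :- (t :- i :* c) :* :- (i :* c)
                                               := κ 1 :* (c :* c :- (κ 1 :- l)) :+ :- (c :* c) :* (i :* i :- :- κ 1)) refl t c i l)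
            ([ c²≈1-l ] ∷ʳ i²≈-1))
          (solve 4 (λ t c i l → l :- i :* t :* c :- l := t :* :- (i :* c)) refl t c i l)
      }

  module _ (2≉0 : ¬ 2# ≈ 0#) where

    2y≉0 : ∀ {y} → ¬ y ≈ 0# → ¬ 2# * y ≈ 0#
    2y≉0 = x≉0∧y≉0⇒x*y≉0 2≉0

    y≉0⇒y≉-y : ∀ {y} → ¬ y ≈ 0# → ¬ y ≈ - y
    y≉0⇒y≉-y y≉0 = y≉0 ∘ x≈-x⇒x≈0 2≉0

    slope-unique : ∀ {x y m} → ¬ y ≈ 0# → m * (2# * y) ≈ N x → slope x y ≈ m
    slope-unique y≉0 m2y≈Nx = *-cancelʳ (2y≉0 y≉0) (trans (x/y*y≈x (2y≉0 y≉0)) (sym m2y≈Nx))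

    double-cong : ∀ {P Q} → P ≈P Q → (P ⊕ P) ≈P (Q ⊕ Q)
    double-cong {∞} {∞} _ = lift tt
    double-cong {⟨ x , y ⟩} {⟨ x' , y' ⟩} (x≈x' , y≈y') = by-cases (y ≟ (- y))
      where
      by-cases : Dec (y ≈ - y) → (⟨ x , y ⟩ ⊕ ⟨ x , y ⟩) ≈P (⟨ x' , y' ⟩ ⊕ ⟨ x' , y' ⟩)
      by-cases (yes y≈-y)
        rewrite ⊕-self-vertical {x} y≈-y
              | ⊕-self-vertical {x'} (trans (sym y≈y') (trans y≈-y (-‿cong y≈y'))) = lift tt
      by-cases (no y≉-y)
        rewrite ⊕-self-tangent {x} y≉-y
              | ⊕-self-tangent {x'} (λ y'≈-y' → y≉-y (trans y≈y' (trans y'≈-y' (-‿cong (sym y≈y'))))) =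
        doubling-cong (*-cong (N-cong x≈x') (⁻¹-cong (2y≉0 (y≉-y ∘ x≈0⇒x≈-x)) (*-congˡ y≈y'))) x≈x' y≈y'

    double-vertical : ∀ {x y} → y ≈ 0# → ⟨ x , y ⟩ ⊕ ⟨ x , y ⟩ ≡ ∞
    double-vertical y≈0 = ⊕-self-vertical (x≈0⇒x≈-x y≈0)

    double-tangent : ∀ {x y m} → ¬ y ≈ 0# → m * (2# * y) ≈ N x → (⟨ x , y ⟩ ⊕ ⟨ x , y ⟩) ≈P doubling m x y
    double-tangent {x} {y} y≉0 m2y≈Nx rewrite ⊕-self-tangent {x} (y≉0⇒y≉-y y≉0) =
      doubling-cong (slope-unique y≉0 m2y≈Nx) refl refl

    -- The classical halving formula: if r₁², r₂², r₃² are x₀, x₀ - 1, x₀ - l, then the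
    -- coordinates of half r₁ r₂ r₃ factor as x = (r₁+r₂)(r₁+r₃), x - 1 = (r₁+r₂)(r₂+r₃),
    -- x - l = (r₁+r₃)(r₂+r₃), and its tangent has slope r₁ + r₂ + r₃.
    halve : ∀ {r₁ r₂ r₃} → ¬ l ≈ 0# → ¬ l ≈ 1# → r₂ * r₂ ≈ r₁ * r₁ - 1# → r₃ * r₃ ≈ r₁ * r₁ - l →
            OnCurve (half r₁ r₂ r₃) × (half r₁ r₂ r₃ ⊕ half r₁ r₂ r₃) ≈P ⟨ r₁ * r₁ , r₁ * r₂ * r₃ ⟩
    halve {r₁} {r₂} {r₃} l≉0 l≉1 h₂ h₃ =
      factored-on-curve x≈AB x-1≈AC x-l≈BC , ≈P-trans (double-tangent ABC≉0 tangent) doubled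
      where
      A = r₁ + r₂ ; B = r₁ + r₃ ; C = r₂ + r₃
      x = r₁ * r₁ + r₁ * r₂ + r₁ * r₃ + r₂ * r₃
      x≈AB : x ≈ A * B
      x≈AB = solve 3 (λ r₁ r₂ r₃ → r₁ :* r₁ :+ r₁ :* r₂ :+ r₁ :* r₃ :+ r₂ :* r₃ := (r₁ :+ r₂) :* (r₁ :+ r₃)) refl r₁ r₂ r₃
      x-1≈AC : x - 1# ≈ A * C
      x-1≈AC = by-combination
        (solve 3 (λ r₁ r₂ r₃ → (r₁ :* r₁ :+ r₁ :* r₂ :+ r₁ :* r₃ :+ r₂ :* r₃ :- κ 1) :- (r₁ :+ r₂) :* (r₂ :+ r₃)
                  := :- κ 1 :* (r₂ :* r₂ :- (r₁ :* r₁ :- κ 1))) refl r₁ r₂ r₃)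
        [ h₂ ]
      x-l≈BC : x - l ≈ B * C
      x-l≈BC = by-combination
        (solve 4 (λ r₁ r₂ r₃ l → (r₁ :* r₁ :+ r₁ :* r₂ :+ r₁ :* r₃ :+ r₂ :* r₃ :- l) :- (r₁ :+ r₃) :* (r₂ :+ r₃)
                  := :- κ 1 :* (r₃ :* r₃ :- (r₁ :* r₁ :- l))) refl r₁ r₂ r₃ l)
        [ h₃ ]
      tangent : (r₁ + r₂ + r₃) * (2# * (A * B * C)) ≈ N x
      tangent = trans
        (solve 3 (λ r₁ r₂ r₃ → (r₁ :+ r₂ :+ r₃) :* (κ 2 :* ((r₁ :+ r₂) :* (r₁ :+ r₃) :* (r₂ :+ r₃)))
                  := ((r₁ :+ r₂) :+ (r₁ :+ r₃) :+ (r₂ :+ r₃)) :* ((r₁ :+ r₂) :* (r₁ :+ r₃) :* (r₂ :+ r₃))) refl r₁ r₂ r₃)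
        (factored-tangent x≈AB x-1≈AC x-l≈BC)
      A≉0 : ¬ A ≈ 0#
      A≉0 A≈0 = 0≉1 (sym (by-combination
        (solve 2 (λ r₁ r₂ → κ 1 :- κ 0 := (r₁ :- r₂) :* ((r₁ :+ r₂) :- κ 0) :+ κ 1 :* (r₂ :* r₂ :- (r₁ :* r₁ :- κ 1))) refl r₁ r₂)
        ([ A≈0 ] ∷ʳ h₂)))
      B≉0 : ¬ B ≈ 0#
      B≉0 B≈0 = l≉0 (by-combination
        (solve 3 (λ r₁ r₃ l → l :- κ 0 := (r₁ :- r₃) :* ((r₁ :+ r₃) :- κ 0) :+ κ 1 :* (r₃ :* r₃ :- (r₁ :* r₁ :- l))) refl r₁ r₃ l)
        ([ B≈0 ] ∷ʳ h₃))
      C≉0 : ¬ C ≈ 0#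
      C≉0 C≈0 = l≉1 (by-combination
        (solve 4 (λ r₁ r₂ r₃ l → l :- κ 1 := (r₂ :- r₃) :* ((r₂ :+ r₃) :- κ 0) :+ :- κ 1 :* (r₂ :* r₂ :- (r₁ :* r₁ :- κ 1))
                                            :+ κ 1 :* (r₃ :* r₃ :- (r₁ :* r₁ :- l))) refl r₁ r₂ r₃ l)
        ([ C≈0 ] ∷ʳ h₂ ∷ʳ h₃))
      ABC≉0 : ¬ A * B * C ≈ 0#
      ABC≉0 = x≉0∧y≉0⇒x*y≉0 (x≉0∧y≉0⇒x*y≉0 A≉0 B≉0) C≉0
      doubled : doubling (r₁ + r₂ + r₃) x (A * B * C) ≈P ⟨ r₁ * r₁ , r₁ * r₂ * r₃ ⟩
      doubled =
        by-combination
          (solve 4 (λ r₁ r₂ r₃ l →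
            let x = r₁ :* r₁ :+ r₁ :* r₂ :+ r₁ :* r₃ :+ r₂ :* r₃ in
            Xₚ l (r₁ :+ r₂ :+ r₃) x :- r₁ :* r₁
            := κ 1 :* (r₂ :* r₂ :- (r₁ :* r₁ :- κ 1)) :+ κ 1 :* (r₃ :* r₃ :- (r₁ :* r₁ :- l))) refl r₁ r₂ r₃ l)
          ([ h₂ ] ∷ʳ h₃) ,
        by-combination
          (solve 4 (λ r₁ r₂ r₃ l →
            let x = r₁ :* r₁ :+ r₁ :* r₂ :+ r₁ :* r₃ :+ r₂ :* r₃ ; m = r₁ :+ r₂ :+ r₃ in
            :- ((r₁ :+ r₂) :* (r₁ :+ r₃) :* (r₂ :+ r₃) :+ m :* (Xₚ l m x :- x)) :- r₁ :* r₂ :* r₃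
            := :- m :* (r₂ :* r₂ :- (r₁ :* r₁ :- κ 1)) :+ :- m :* (r₃ :* r₃ :- (r₁ :* r₁ :- l))) refl r₁ r₂ r₃ l)
          ([ h₂ ] ∷ʳ h₃)

    -- A 4-torsion point is 2-torsion, or it is a half of a 2-torsion point (e, 0); the
    -- tangent at it then passes through (e, 0), which forces (x - e)² = f′(e).
    four-torsion : ∀ {x y} → y * y ≈ f x → [4] ⟨ x , y ⟩ ≈P ∞ →
                   y ≈ 0# ⊎ Σ Carrier λ e → f e ≈ 0# × (x - e) * (x - e) ≈ N e
    four-torsion {x} {y} y²≈fx 4P≈∞ with y ≟ 0#
    ... | yes y≈0 = inj₁ y≈0
    ... | no y≉0  = inj₂ (X , fX≈0 , x-y≈0⇒x≈y _ _ (x*x≈0⇒x≈0 D²≈0))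
      where
      m = slope x y
      X = m * m - a₂ - x - x
      Y = - (y + m * (X - x))
      m2y≈Nx : m * (2# * y) ≈ N x
      m2y≈Nx = x/y*y≈x (2y≉0 y≉0)
      Y≈0 : Y ≈ 0#
      Y≈0 = x≈-x⇒x≈0 2≉0 (double≈∞⇒vertical
        (≡.subst (λ Q → (Q ⊕ Q) ≈P ∞) (⊕-self-tangent (y≉0⇒y≉-y y≉0)) 4P≈∞))
      fX≈0 : f X ≈ 0#
      fX≈0 = trans (sym (doubling-on-curve y²≈fx m2y≈Nx)) (trans (*-cong Y≈0 Y≈0) (zeroˡ 0#))
      D = (x - X) * (x - X) - N X
      D²≈0 : D * D ≈ 0#
      D²≈0 = begin
        D * D                                ≈⟨ doubling-x-sub-root y²≈fx m2y≈Nx fX≈0 ⟨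
        (X - X) * ((2# * y) * (2# * y))      ≈⟨ *-congʳ (-‿inverseʳ X) ⟩
        0# * ((2# * y) * (2# * y))           ≈⟨ zeroˡ _ ⟩
        0#                                   ∎

    -- If 4P = (0, 0) then x(2P) = w² by the doubling formula, and x(2P)² = l because
    -- 2P is a half of (0, 0).
    four-times≈origin⇒fourth-power : ∀ {x y} → y * y ≈ f x → [4] ⟨ x , y ⟩ ≈P ⟨ 0# , 0# ⟩ →
                                     Σ Carrier λ w → (w * w) * (w * w) ≈ l
    four-times≈origin⇒fourth-power {x} {y} y²≈fx 4P≈O with y ≟ 0#
    ... | yes y≈0 = ⊥-elim (lower (≡.subst (λ Q → (Q ⊕ Q) ≈P ⟨ 0# , 0# ⟩) (double-vertical {x} y≈0) 4P≈O))
    ... | no y≉0  = w , (begin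
        (w * w) * (w * w)    ≈⟨ *-cong X≈w² X≈w² ⟨
        (X - 0#) * (X - 0#)  ≈⟨ x-y≈0⇒x≈y _ _ (x*x≈0⇒x≈0 D₂²≈0) ⟩
        N 0#                 ≈⟨ N[0]≈l ⟩
        l                    ∎)
      where
      m = slope x y
      X = m * m - a₂ - x - x
      Y = - (y + m * (X - x))
      m2y≈Nx : m * (2# * y) ≈ N x
      m2y≈Nx = x/y*y≈x (2y≉0 y≉0)
      2P≡ : ⟨ x , y ⟩ ⊕ ⟨ x , y ⟩ ≡ ⟨ X , Y ⟩
      2P≡ = ⊕-self-tangent (y≉0⇒y≉-y y≉0)
      Y≉-Y : ¬ Y ≈ - Y
      Y≉-Y Y≈-Y = lower (≡.subst (_≈P ⟨ 0# , 0# ⟩) (⊕-self-vertical {X} Y≈-Y)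
                           (≡.subst (λ Q → (Q ⊕ Q) ≈P ⟨ 0# , 0# ⟩) 2P≡ 4P≈O))
      m₂ = slope X Y
      X₄≈0 : m₂ * m₂ - a₂ - X - X ≈ 0#
      X₄≈0 = proj₁ (≡.subst (_≈P ⟨ 0# , 0# ⟩) (⊕-self-tangent {X} Y≉-Y)
                      (≡.subst (λ Q → (Q ⊕ Q) ≈P ⟨ 0# , 0# ⟩) 2P≡ 4P≈O))
      D₂ = (X - 0#) * (X - 0#) - N 0#
      D₂²≈0 : D₂ * D₂ ≈ 0#
      D₂²≈0 = begin
        D₂ * D₂                                         ≈⟨ doubling-x-sub-root (doubling-on-curve y²≈fx m2y≈Nx)
                                                             (x/y*y≈x (2y≉0 (Y≉-Y ∘ x≈0⇒x≈-x))) f[0]≈0 ⟨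
        (m₂ * m₂ - a₂ - X - X - 0#) * ((2# * Y) * (2# * Y)) ≈⟨ *-congʳ (trans (+-congʳ X₄≈0) (-‿inverseʳ 0#)) ⟩
        0# * ((2# * Y) * (2# * Y))                      ≈⟨ zeroˡ _ ⟩
        0#                                              ∎
      D = (x - 0#) * (x - 0#) - N 0#
      w = D / (2# * y)
      X≈w² : X - 0# ≈ w * w
      X≈w² = *-cancelʳ (x≉0∧y≉0⇒x*y≉0 (2y≉0 y≉0) (2y≉0 y≉0)) (begin
        (X - 0#) * ((2# * y) * (2# * y))   ≈⟨ doubling-x-sub-root y²≈fx m2y≈Nx f[0]≈0 ⟩
        D * D                              ≈⟨ *-cong (x/y*y≈x (2y≉0 y≉0)) (x/y*y≈x (2y≉0 y≉0)) ⟨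
        (w * (2# * y)) * (w * (2# * y))    ≈⟨ solve 2 (λ w z → (w :* z) :* (w :* z) := (w :* w) :* (z :* z)) refl w (2# * y) ⟩
        (w * w) * ((2# * y) * (2# * y))    ∎)

    -- Halving (0, 0) and then the resulting point (t, …) gives R with 4R = (0, 0).
    quarter-of-origin : ∀ {t u v i} → ¬ l ≈ 0# → ¬ l ≈ 1# →
                        t * t ≈ l → u * u ≈ t → v * v ≈ t - 1# → i * i ≈ - 1# → Origin∈4E
    quarter-of-origin {t} {u} {v} {i} l≉0 l≉1 t²≈l u²≈t v²≈t-1 i²≈-1 =
      half u v (i * u * v) , proj₁ halve₂ ,
      ≈P-trans (double-cong (≈P-trans (proj₂ halve₂) 2H₂≈H₁)) (≈P-trans (proj₂ halve₁) 2H₁≈O)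
      where
      halve₁ = halve {0#} { - i} {i * t} l≉0 l≉1
        (by-combination (solve 1 (λ i → :- i :* :- i :- (κ 0 :* κ 0 :- κ 1) := κ 1 :* (i :* i :- :- κ 1)) refl i)
          [ i²≈-1 ])
        (by-combination (solve 3 (λ i t l → (i :* t) :* (i :* t) :- (κ 0 :* κ 0 :- l)
                                           := t :* t :* (i :* i :- :- κ 1) :+ :- κ 1 :* (t :* t :- l)) refl i t l)
          ([ i²≈-1 ] ∷ʳ t²≈l))
      halve₂ = halve {u} {v} {i * u * v} l≉0 l≉1
        (by-combination (solve 3 (λ t u v → v :* v :- (u :* u :- κ 1)
                                           := κ 1 :* (v :* v :- (t :- κ 1)) :+ :- κ 1 :* (u :* u :- t)) refl t u v)
          ([ v²≈t-1 ] ∷ʳ u²≈t))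
        (by-combination (solve 5 (λ t u v i l → (i :* u :* v) :* (i :* u :* v) :- (u :* u :- l)
                                             := u :* u :* v :* v :* (i :* i :- :- κ 1) :+ (:- (v :* v) :- κ 1) :* (u :* u :- t)
                                                :+ :- t :* (v :* v :- (t :- κ 1)) :+ :- κ 1 :* (t :* t :- l)) refl t u v i l)
          ([ i²≈-1 ] ∷ʳ u²≈t ∷ʳ v²≈t-1 ∷ʳ t²≈l))
      2H₂≈H₁ : ⟨ u * u , u * v * (i * u * v) ⟩ ≈P half 0# (- i) (i * t)
      2H₂≈H₁ =
        by-combination
          (solve 3 (λ t u i → u :* u :- (κ 0 :* κ 0 :+ κ 0 :* :- i :+ κ 0 :* (i :* t) :+ :- i :* (i :* t))
                             := κ 1 :* (u :* u :- t) :+ t :* (i :* i :- :- κ 1)) refl t u i)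
          ([ u²≈t ] ∷ʳ i²≈-1) ,
        by-combination
          (solve 4 (λ t u v i → u :* v :* (i :* u :* v) :- (κ 0 :+ :- i) :* (κ 0 :+ i :* t) :* (:- i :+ i :* t)
                               := (t :* t :* i :- t :* i) :* (i :* i :- :- κ 1) :+ v :* v :* i :* (u :* u :- t)
                                  :+ t :* i :* (v :* v :- (t :- κ 1))) refl t u v i)
          ([ i²≈-1 ] ∷ʳ u²≈t ∷ʳ v²≈t-1)
      2H₁≈O : ⟨ 0# * 0# , 0# * - i * (i * t) ⟩ ≈P ⟨ 0# , 0# ⟩
      2H₁≈O = zeroˡ 0# , solve 2 (λ i t → κ 0 :* :- i :* (i :* t) := κ 0) refl i t

    -- Halving (1, 0) gives a point of order 4 with x = 1 + g.
    order-four-point : ∀ {g} → ¬ l ≈ 0# → ¬ l ≈ 1# → g * g ≈ 1# - l →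
                       OnCurve (half 1# 0# g) × [4] (half 1# 0# g) ≈P ∞
    order-four-point {g} l≉0 l≉1 g²≈1-l =
      proj₁ halve₁ ,
      ≈P-trans (double-cong (proj₂ halve₁))
               (≡.subst (_≈P ∞) (≡.sym (double-vertical {1# * 1#} 1*0*g≈0)) (lift tt))
      where
      halve₁ = halve {1#} {0#} {g} l≉0 l≉1
        (solve 0 (κ 0 :* κ 0 := κ 1 :* κ 1 :- κ 1) refl)
        (by-combination (solve 2 (λ g l → g :* g :- (κ 1 :* κ 1 :- l) := κ 1 :* (g :* g :- (κ 1 :- l))) refl g l)
          [ g²≈1-l ])
      1*0*g≈0 : 1# * 0# * g ≈ 0#
      1*0*g≈0 = solve 1 (λ g → κ 1 :* κ 0 :* g := κ 0) refl g

module Embedding {c ℓ c′ ℓ′} (F : Field c ℓ) (L : Field c′ ℓ′) (ι : Field.Carrier F → Field.Carrier L)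
                 (ι-hom : IsFieldHom F L ι) (l : Field.Carrier F) where
  open Field L
  open FieldProperties L
  open Legendre L (ι l)
  open RingMorphisms.IsRingHomomorphism ι-hom using (+-homo; *-homo; -‿homo; 0#-homo; 1#-homo; ⟦⟧-cong)
  private
    module F  = Field F
    module FF = FieldProperties F
    module EF = LegendreCurve F l
    module EL = LegendreCurve L (ι l)

  ι-‿- : ∀ u v → ι (u F.- v) ≈ ι u - ι v
  ι-‿- u v = trans (+-homo u (F.- v)) (+-congˡ (-‿homo v))

  ι-f : ∀ X → ι (EF.f X) ≈ EL.f (ι X)
  ι-f X = trans (*-homo _ _)
    (*-cong (trans (*-homo _ _) (*-congˡ (trans (ι-‿- X F.1#) (x-a-cong 1#-homo)))) (ι-‿- X l))

  ι-nonzero : ∀ {u} → ¬ u F.≈ F.0# → ¬ ι u ≈ 0#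
  ι-nonzero {u} u≉0 ιu≈0 = 0≉1 (begin
    0#                ≈⟨ zeroˡ _ ⟨
    0# * ι (u F.⁻¹)   ≈⟨ *-congʳ ιu≈0 ⟨
    ι u * ι (u F.⁻¹)  ≈⟨ *-homo u _ ⟨
    ι (u F.* u F.⁻¹)  ≈⟨ ⟦⟧-cong (F.⁻¹-inverse u u≉0) ⟩
    ι F.1#            ≈⟨ 1#-homo ⟩
    1#                ∎)

  Rational : Pt Carrier → Set _
  Rational P = Σ (Pt F.Carrier) λ Q → Legendre.OnCurve F l Q × mapPt ι Q ≈P P

  lift-point : ∀ {x y X Y} → x ≈ ι X → Y F.* Y F.≈ EF.f X → y * y ≈ EL.f x → Rational ⟨ x , y ⟩
  lift-point {x} {y} {X} {Y} x≈ιX Y²≈fX y²≈fx =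
    [ (λ y≈ιY → ⟨ X , Y ⟩ , Y²≈fX , sym x≈ιX , sym y≈ιY)
    , (λ y≈-ιY → ⟨ X , F.- Y ⟩ , F.trans (FF.-x*-x≈x*x Y) Y²≈fX , sym x≈ιX , trans (-‿homo Y) (sym y≈-ιY))
    ]′ (x*x≈y*y⇒x≈±y (begin
      y * y        ≈⟨ y²≈fx ⟩
      EL.f x       ≈⟨ EL.f-cong x≈ιX ⟩
      EL.f (ι X)   ≈⟨ ι-f X ⟨
      ι (EF.f X)   ≈⟨ ⟦⟧-cong Y²≈fX ⟨
      ι (Y F.* Y)  ≈⟨ *-homo Y Y ⟩
      ι Y * ι Y    ∎))

  lift-half : ∀ {e d x y} → EF.RationalHalves e d → (x - ι e) * (x - ι e) ≈ ι d → y * y ≈ EL.f x → Rational ⟨ x , y ⟩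
  lift-half {e} H x-e²≈d y²≈fx =
    [ (λ x-e≈r → lift-point (trans (x-a≈b⇒x≈a+b x-e≈r) (sym (+-homo e r))) y₊-on-curve y²≈fx)
    , (λ x-e≈-r → lift-point (trans (x-a≈-b⇒x≈a-b x-e≈-r) (sym (ι-‿- e r))) y₋-on-curve y²≈fx)
    ]′ (x*x≈y*y⇒x≈±y (trans x-e²≈d (trans (⟦⟧-cong (F.sym r*r≈d)) (*-homo r r))))
    where open EF.RationalHalves H

  lift-four-torsion : ¬ F.2# F.≈ F.0# →
    EF.RationalHalves F.0# l → EF.RationalHalves F.1# (F.1# F.- l) → EF.RationalHalves l (l F.* (l F.- F.1#)) →
    ∀ P → OnCurve P → [4] P ≈P ∞ → Rational P
  lift-four-torsion 2≉0 over-0 over-1 over-l ∞ _ _ = ∞ , lift tt , lift tt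
  lift-four-torsion 2≉0 over-0 over-1 over-l ⟨ x , y ⟩ y²≈fx 4P≈∞ =
    [ (λ y≈0 → two-torsion (EL.f≈0⇒root (trans (sym y²≈fx) (trans (*-congʳ y≈0) (zeroˡ y)))))
    , (λ (e , fe≈0 , x-e²≈Ne) → over-root x-e²≈Ne (EL.f≈0⇒root fe≈0))
    ]′ (EL.four-torsion 2≉0ᴸ y²≈fx 4P≈∞)
    where
    2≉0ᴸ : ¬ 2# ≈ 0#
    2≉0ᴸ 2≈0 = ι-nonzero 2≉0 (trans (+-homo F.1# F.1#) (trans (+-cong 1#-homo 1#-homo) 2≈0))
    on-curve : ∀ {e} → EF.f e F.≈ F.0# → F.0# F.* F.0# F.≈ EF.f e
    on-curve fe≈0 = F.trans (F.zeroˡ F.0#) (F.sym fe≈0)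
    two-torsion : x ≈ 0# ⊎ x ≈ 1# ⊎ x ≈ ι l → Rational ⟨ x , y ⟩
    two-torsion (inj₁ x≈0)        = lift-point (trans x≈0 (sym 0#-homo)) (on-curve EF.f[0]≈0) y²≈fx
    two-torsion (inj₂ (inj₁ x≈1)) = lift-point (trans x≈1 (sym 1#-homo)) (on-curve EF.f[1]≈0) y²≈fx
    two-torsion (inj₂ (inj₂ x≈l)) = lift-point x≈l (on-curve EF.f[l]≈0) y²≈fx
    over : ∀ {e e′ d} → EF.RationalHalves e′ d → (x - e) * (x - e) ≈ EL.N e → e ≈ ι e′ → EL.N e ≈ ι d →
           Rational ⟨ x , y ⟩
    over H x-e²≈Ne e≈ιe′ Ne≈ιd = lift-half H (trans (*-cong (x-a-cong (sym e≈ιe′)) (x-a-cong (sym e≈ιe′)))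
                                                     (trans x-e²≈Ne Ne≈ιd)) y²≈fx
    over-root : ∀ {e} → (x - e) * (x - e) ≈ EL.N e → e ≈ 0# ⊎ e ≈ 1# ⊎ e ≈ ι l → Rational ⟨ x , y ⟩
    over-root x-e²≈Ne (inj₁ e≈0) =
      over over-0 x-e²≈Ne (trans e≈0 (sym 0#-homo)) (trans (EL.N-cong e≈0) EL.N[0]≈l)
    over-root x-e²≈Ne (inj₂ (inj₁ e≈1)) =
      over over-1 x-e²≈Ne (trans e≈1 (sym 1#-homo))
        (trans (EL.N-cong e≈1) (trans EL.N[1]≈1-l (sym (trans (ι-‿- F.1# l) (+-congʳ 1#-homo)))))
    over-root x-e²≈Ne (inj₂ (inj₂ e≈l)) =
      over over-l x-e²≈Ne e≈l
        (trans (EL.N-cong e≈l) (trans EL.N[l]≈l[l-1] (sym (trans (*-homo l _) (*-congˡ (trans (ι-‿- l F.1#) (x-a-cong 1#-homo)))))))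

module FiniteField {c ℓ} (F : Field c ℓ) {q : ℕ} (card : HasCardinality F q) (q≡1[4] : q % 4 ≡ 1) where
  open Field F
  open FieldProperties F
  open HasCardinality card
  open import Data.List.Membership.Setoid setoid using (_∈_)
  open import Data.List.Membership.Setoid.Properties using (∈-tabulate⁺; ∈-filter⁺; ∈-filter⁻; ∈-resp-≈; All[≉]⇒∉)
  open import Data.List.Relation.Unary.Unique.Setoid setoid using (Unique)
  import Data.List.Relation.Unary.Unique.Setoid.Properties as Unique
  open import Algebra.Properties.CommutativeSemiring.Exp commutativeSemiring using (_^_; ^-congˡ; ^-distrib-*; ^-assocʳ)

  ∏ : List Carrier → Carrier
  ∏ = foldr _*_ 1#

  remove : Carrier → List Carrier → List Carrier
  remove x = filter (λ y → ¬? (y ≟ x))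

  ∈-remove⁺ : ∀ {x y xs} → y ∈ xs → ¬ y ≈ x → y ∈ remove x xs
  ∈-remove⁺ {x} = ∈-filter⁺ setoid (λ y → ¬? (y ≟ x)) (λ y≈z y≉x z≈x → y≉x (trans y≈z z≈x))

  ∈-remove⁻ : ∀ {x y xs} → y ∈ remove x xs → y ∈ xs × ¬ y ≈ x
  ∈-remove⁻ {x} = ∈-filter⁻ setoid (λ y → ¬? (y ≟ x)) (λ y≈z y≉x z≈x → y≉x (trans y≈z z≈x))

  remove-unique : ∀ {x xs} → Unique xs → Unique (remove x xs)
  remove-unique {x} = Unique.filter⁺ setoid (λ y → ¬? (y ≟ x))

  private
    remove-head : ∀ {x y ys} → y ≈ x → All (λ z → ¬ y ≈ z) ys → remove x ys ≡ ys
    remove-head {x} y≈x y≉ys = filter-all (λ z → ¬? (z ≟ x)) (All.map (λ y≉z z≈x → y≉z (trans y≈x (sym z≈x))) y≉ys)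

  length-remove : ∀ {x xs} → Unique xs → x ∈ xs → length xs ≡ suc (length (remove x xs))
  length-remove {x} {y ∷ ys} (y≉ys ∷ uniq) x∈xs with y ≟ x
  ... | yes y≈x = ≡.cong (suc ∘ length) (≡.sym (remove-head y≈x y≉ys))
  ... | no y≉x with x∈xs
  ...   | here x≈y    = contradiction (sym x≈y) y≉x
  ...   | there x∈ys  = ≡.cong suc (length-remove uniq x∈ys)

  ∏-remove : ∀ {x xs} → Unique xs → x ∈ xs → ∏ xs ≈ x * ∏ (remove x xs)
  ∏-remove {x} {y ∷ ys} (y≉ys ∷ uniq) x∈xs with y ≟ x
  ... | yes y≈x = *-cong y≈x (reflexive (≡.cong ∏ (≡.sym (remove-head y≈x y≉ys))))
  ... | no y≉x with x∈xs
  ...   | here x≈y    = contradiction (sym x≈y) y≉x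
  ...   | there x∈ys  = begin
    y * ∏ ys                        ≈⟨ *-congˡ (∏-remove uniq x∈ys) ⟩
    y * (x * ∏ (remove x ys))       ≈⟨ solve 3 (λ y x p → y :* (x :* p) := x :* (y :* p)) refl y x _ ⟩
    x * (y * ∏ (remove x ys))       ∎

  -- A duplicate-free list closed under a fixed-point-free involution σ splits into pairs
  -- {z, σ z}; if every pair has product k, the whole list has product k ^ (number of pairs).
  module Pairing (σ : Carrier → Carrier) (σ-cong : ∀ {x y} → x ≈ y → σ x ≈ σ y)
                 (σ-involutive : ∀ x → σ (σ x) ≈ x) where

    pairing : ∀ n xs → length xs ≡ n → Unique xs → (∀ {x} → x ∈ xs → σ x ∈ xs) → (∀ {x} → x ∈ xs → ¬ σ x ≈ x) →
              Σ ℕ λ m → n ≡ m ℕ.+ m × (∀ {k} → (∀ {x} → x ∈ xs → x * σ x ≈ k) → ∏ xs ≈ k ^ m)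
    pairing zero [] _ _ _ _ = 0 , ≡.refl , λ _ → refl
    pairing (suc zero) (x ∷ []) _ _ closed fixed-free with closed (here refl)
    ... | here σx≈x = contradiction σx≈x (fixed-free (here refl))
    pairing (suc (suc n)) (x ∷ xs) length≡ (x≉xs ∷ uniq) closed fixed-free = suc m , length-even , product
      where
      σx∈xs : σ x ∈ xs
      σx∈xs with closed (here refl)
      ... | here σx≈x  = contradiction σx≈x (fixed-free (here refl))
      ... | there σx∈xs = σx∈xs
      rest = remove (σ x) xs
      in-rest : ∀ {z} → z ∈ rest → z ∈ x ∷ xs
      in-rest z∈rest = there (proj₁ (∈-remove⁻ z∈rest))
      rest-closed : ∀ {z} → z ∈ rest → σ z ∈ rest
      rest-closed {z} z∈rest with ∈-remove⁻ z∈rest | closed (in-rest z∈rest)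
      ... | z∈xs , z≉σx | here σz≈x = contradiction (trans (sym (σ-involutive z)) (σ-cong σz≈x)) z≉σx
      ... | z∈xs , z≉σx | there σz∈xs = ∈-remove⁺ σz∈xs λ σz≈σx →
        All[≉]⇒∉ setoid x≉xs (∈-resp-≈ setoid (trans (sym (σ-involutive z)) (trans (σ-cong σz≈σx) (σ-involutive x))) z∈xs)
      recursion = pairing n rest
        (ℕ.suc-injective (≡.trans (≡.sym (length-remove uniq σx∈xs)) (ℕ.suc-injective length≡)))
        (remove-unique uniq) rest-closed (fixed-free ∘ in-rest)
      m = proj₁ recursion
      length-even : suc (suc n) ≡ suc m ℕ.+ suc m
      length-even = ≡.cong suc (≡.trans (≡.cong suc (proj₁ (proj₂ recursion))) (≡.sym (ℕ.+-suc m m)))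
      product : ∀ {k} → (∀ {z} → z ∈ x ∷ xs → z * σ z ≈ k) → ∏ (x ∷ xs) ≈ k ^ suc m
      product {k} pairs = begin
        x * ∏ xs              ≈⟨ *-congˡ (∏-remove uniq σx∈xs) ⟩
        x * (σ x * ∏ rest)    ≈⟨ *-assoc x (σ x) _ ⟨
        (x * σ x) * ∏ rest    ≈⟨ *-cong (pairs (here refl)) (proj₂ (proj₂ recursion) (pairs ∘ in-rest)) ⟩
        k * k ^ m             ∎

  private
    m+m≢1+n+n : ∀ m n → m ℕ.+ m ≢ suc (n ℕ.+ n)
    m+m≢1+n+n zero    n ()
    m+m≢1+n+n (suc m) zero    eq rewrite ℕ.+-suc m m = contradiction (ℕ.suc-injective eq) λ ()
    m+m≢1+n+n (suc m) (suc n) eq rewrite ℕ.+-suc m m | ℕ.+-suc n n =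
      m+m≢1+n+n m n (ℕ.suc-injective (ℕ.suc-injective eq))

    m+m≡n+n⇒m≡n : ∀ {m n} → m ℕ.+ m ≡ n ℕ.+ n → m ≡ n
    m+m≡n+n⇒m≡n {zero}  {zero}  _  = ≡.refl
    m+m≡n+n⇒m≡n {suc m} {suc n} eq rewrite ℕ.+-suc m m | ℕ.+-suc n n =
      ≡.cong suc (m+m≡n+n⇒m≡n (ℕ.suc-injective (ℕ.suc-injective eq)))

  elements : List Carrier
  elements = tabulate enum

  elements-unique : Unique elements
  elements-unique = Unique.tabulate⁺ setoid (λ {i} {j} → injective i j)

  ∈-elements : ∀ x → x ∈ elements
  ∈-elements x = ∈-resp-≈ setoid (proj₂ (surjective x)) (∈-tabulate⁺ setoid (proj₁ (surjective x)))

  k : ℕ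
  k = q ℕ./ 4

  q≡1+2k+2k : q ≡ suc (k ℕ.* 2 ℕ.+ k ℕ.* 2)
  q≡1+2k+2k = ≡.trans (m≡m%n+[m/n]*n q 4) (≡.cong₂ ℕ._+_ q≡1[4] (ℕ.*-distribˡ-+ k 2 2))

  -- Pairing each x with x + 1 would make q even.
  2≉0 : ¬ 2# ≈ 0#
  2≉0 2≈0 = m+m≢1+n+n (proj₁ pairs) (k ℕ.* 2) (≡.trans (≡.sym (proj₁ (proj₂ pairs))) q≡1+2k+2k)
    where
    open Pairing (_+ 1#) +-congʳ
      (λ x → by-combination (solve 1 (λ x → x :+ κ 1 :+ κ 1 :- x := κ 1 :* (κ 2 :- κ 0)) refl x) [ 2≈0 ])
    x+1≉x : ∀ {x} → ¬ x + 1# ≈ x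
    x+1≉x {x} x+1≈x = 0≉1 (sym (by-combination (solve 1 (λ x → κ 1 :- κ 0 := κ 1 :* (x :+ κ 1 :- x)) refl x) [ x+1≈x ]))
    pairs = pairing q elements (length-tabulate enum) elements-unique (λ _ → ∈-elements _) (λ _ → x+1≉x)

  square? : ∀ x → Dec (IsSquare x)
  square? x = map′ satisfied
    (λ (r , r²≈x) → Any.map (λ r≈y → trans (*-cong (sym r≈y) (sym r≈y)) r²≈x) (∈-elements r))
    (any? (λ r → (r * r) ≟ x) elements)

  nonzero : List Carrier
  nonzero = remove 0# elements

  nonzero-unique : Unique nonzero
  nonzero-unique = remove-unique {xs = elements} elements-unique

  length-nonzero : length nonzero ≡ k ℕ.* 2 ℕ.+ k ℕ.* 2
  length-nonzero = ℕ.suc-injective (≡.trans (≡.sym (length-remove elements-unique (∈-elements 0#)))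
                                            (≡.trans (length-tabulate enum) q≡1+2k+2k))

  ∈-nonzero : ∀ {x} → ¬ x ≈ 0# → x ∈ nonzero
  ∈-nonzero x≉0 = ∈-remove⁺ (∈-elements _) x≉0

  ∈-nonzero⇒≉0 : ∀ {x} → x ∈ nonzero → ¬ x ≈ 0#
  ∈-nonzero⇒≉0 = proj₂ ∘ ∈-remove⁻ {xs = elements}

  module Reciprocal {n : Carrier} (n≉0 : ¬ n ≈ 0#) where

    -- z ↦ n / z, extended by 0 ↦ 0 to an involution of the whole field
    partner : Carrier → Carrier
    partner z = by-cases (z ≟ 0#)
      where
      by-cases : Dec (z ≈ 0#) → Carrier
      by-cases (yes _) = 0#
      by-cases (no _)  = n * z ⁻¹

    partner-≈0 : ∀ {z} → z ≈ 0# → partner z ≈ 0#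
    partner-≈0 {z} z≈0 with z ≟ 0#
    ... | yes _   = refl
    ... | no z≉0  = contradiction z≈0 z≉0

    z*partner[z]≈n : ∀ {z} → ¬ z ≈ 0# → z * partner z ≈ n
    z*partner[z]≈n {z} z≉0 with z ≟ 0#
    ... | yes z≈0 = contradiction z≈0 z≉0
    ... | no _    = by-combination
      (solve 3 (λ z n z⁻¹ → z :* (n :* z⁻¹) :- n := n :* (z :* z⁻¹ :- κ 1)) refl z n (z ⁻¹))
      [ ⁻¹-inverse z z≉0 ]

    partner-unique : ∀ {z w} → ¬ z ≈ 0# → z * w ≈ n → partner z ≈ w
    partner-unique z≉0 zw≈n = *-cancelʳ z≉0 (trans (*-comm _ _) (trans (z*partner[z]≈n z≉0) (trans (sym zw≈n) (*-comm _ _))))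

    partner-nonzero : ∀ {z} → ¬ z ≈ 0# → ¬ partner z ≈ 0#
    partner-nonzero z≉0 p≈0 = n≉0 (trans (sym (z*partner[z]≈n z≉0)) (trans (*-congˡ p≈0) (zeroʳ _)))

    partner-cong : ∀ {z z′} → z ≈ z′ → partner z ≈ partner z′
    partner-cong {z} {z′} z≈z′ = by-cases (z′ ≟ 0#)
      where
      by-cases : Dec (z′ ≈ 0#) → partner z ≈ partner z′
      by-cases (yes z′≈0) = trans (partner-≈0 (trans z≈z′ z′≈0)) (sym (partner-≈0 z′≈0))
      by-cases (no z′≉0)  = partner-unique (λ z≈0 → z′≉0 (trans (sym z≈z′) z≈0))
                              (trans (*-congʳ z≈z′) (z*partner[z]≈n z′≉0))

    partner-involutive : ∀ z → partner (partner z) ≈ z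
    partner-involutive z = by-cases (z ≟ 0#)
      where
      by-cases : Dec (z ≈ 0#) → partner (partner z) ≈ z
      by-cases (yes z≈0) = trans (partner-≈0 (partner-≈0 z≈0)) (sym z≈0)
      by-cases (no z≉0)  = partner-unique (partner-nonzero z≉0) (trans (*-comm _ _) (z*partner[z]≈n z≉0))

    open Pairing partner partner-cong partner-involutive

    private
      pairs-in-nonzero : ∀ {xs} → (∀ {z} → z ∈ xs → z ∈ nonzero) → ∀ {z} → z ∈ xs → z * partner z ≈ n
      pairs-in-nonzero ⊆nonzero = z*partner[z]≈n ∘ ∈-nonzero⇒≉0 ∘ ⊆nonzero

    ∏-nonzero-nonsquare : ¬ IsSquare n → ∏ nonzero ≈ n ^ (k ℕ.* 2)
    ∏-nonzero-nonsquare n-nonsquare = ≡.subst (λ m → ∏ nonzero ≈ n ^ m) m≡2k (proj₂ (proj₂ pairs) (pairs-in-nonzero id))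
      where
      pairs = pairing _ nonzero ≡.refl nonzero-unique
        (λ z∈ → ∈-nonzero (partner-nonzero (∈-nonzero⇒≉0 z∈)))
        (λ {z} z∈ p≈z → n-nonsquare (z , trans (*-congˡ (sym p≈z)) (z*partner[z]≈n (∈-nonzero⇒≉0 z∈))))
      m≡2k : proj₁ pairs ≡ k ℕ.* 2
      m≡2k = m+m≡n+n⇒m≡n (≡.trans (≡.sym (proj₁ (proj₂ pairs))) length-nonzero)

    -- The fixed points of z ↦ n / z are ± s; removing them leaves the pairs.
    ∏-nonzero-square : ∀ {s} → s * s ≈ n → ∏ nonzero ≈ - n ^ (k ℕ.* 2)
    ∏-nonzero-square {s} s²≈n = begin
      ∏ nonzero                  ≈⟨ ∏-remove nonzero-unique s∈ ⟩
      s * ∏ without-s            ≈⟨ *-congˡ (∏-remove (remove-unique nonzero-unique) -s∈) ⟩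
      s * (- s * ∏ without-±s)   ≈⟨ *-congˡ (*-congˡ (proj₂ (proj₂ pairs) (pairs-in-nonzero in-nonzero))) ⟩
      s * (- s * n ^ m)          ≈⟨ by-combination
                                      (solve 3 (λ s n p → s :* (:- s :* p) :- :- (n :* p) := :- p :* (s :* s :- n)) refl s n (n ^ m))
                                      [ s²≈n ] ⟩
      - (n * n ^ m)              ≡⟨ ≡.cong (λ m → - n ^ m) 1+m≡2k ⟩
      - n ^ (k ℕ.* 2)            ∎
      where
      s≉0 : ¬ s ≈ 0#
      s≉0 s≈0 = n≉0 (trans (sym s²≈n) (trans (*-congʳ s≈0) (zeroˡ s)))
      -s≉0 : ¬ - s ≈ 0#
      -s≉0 -s≈0 = s≉0 (trans (sym (-‿involutive s)) (trans (-‿cong -s≈0) -0#≈0#))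
      s∈ = ∈-nonzero s≉0
      -s∈ = ∈-remove⁺ (∈-nonzero -s≉0) (λ -s≈s → s≉0 (x≈-x⇒x≈0 2≉0 (sym -s≈s)))
      without-s = remove s nonzero
      without-±s = remove (- s) without-s
      in-nonzero : ∀ {z} → z ∈ without-±s → z ∈ nonzero
      in-nonzero = proj₁ ∘ ∈-remove⁻ {xs = nonzero} ∘ proj₁ ∘ ∈-remove⁻ {xs = without-s}
      partner-fixed : ∀ {z} → z * z ≈ n → partner z ≈ z
      partner-fixed {z} z²≈n = partner-unique (λ z≈0 → n≉0 (trans (sym z²≈n) (trans (*-congʳ z≈0) (zeroˡ z)))) z²≈n
      closed : ∀ {z} → z ∈ without-±s → partner z ∈ without-±s
      closed {z} z∈ = ∈-remove⁺ (∈-remove⁺ (∈-nonzero (partner-nonzero (∈-nonzero⇒≉0 (in-nonzero z∈)))) p≉s) p≉-s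
        where
        avoids : ∀ {w} → ¬ z ≈ w → w * w ≈ n → ¬ partner z ≈ w
        avoids z≉w w²≈n p≈w = z≉w (trans (sym (partner-involutive z)) (trans (partner-cong p≈w) (partner-fixed w²≈n)))
        p≉s = avoids (proj₂ (∈-remove⁻ {xs = nonzero} (proj₁ (∈-remove⁻ {xs = without-s} z∈)))) s²≈n
        p≉-s = avoids (proj₂ (∈-remove⁻ {xs = without-s} z∈)) (trans (-x*-x≈x*x s) s²≈n)
      fixed-free : ∀ {z} → z ∈ without-±s → ¬ partner z ≈ z
      fixed-free {z} z∈ p≈z with x*x≈y*y⇒x≈±y (trans (trans (*-congˡ (sym p≈z)) (z*partner[z]≈n (∈-nonzero⇒≉0 (in-nonzero z∈)))) (sym s²≈n))
      ... | inj₁ z≈s  = proj₂ (∈-remove⁻ {xs = nonzero} (proj₁ (∈-remove⁻ {xs = without-s} z∈))) z≈s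
      ... | inj₂ z≈-s = proj₂ (∈-remove⁻ {xs = without-s} z∈) z≈-s
      pairs = pairing _ without-±s ≡.refl (remove-unique (remove-unique nonzero-unique)) closed fixed-free
      m = proj₁ pairs
      1+m≡2k : suc m ≡ k ℕ.* 2
      1+m≡2k = m+m≡n+n⇒m≡n (≡.trans (≡.cong suc (ℕ.+-suc m m))
        (≡.trans (≡.cong (suc ∘ suc) (≡.sym (proj₁ (proj₂ pairs))))
          (≡.trans (≡.cong suc (≡.sym (length-remove (remove-unique nonzero-unique) -s∈)))
            (≡.trans (≡.sym (length-remove nonzero-unique s∈)) length-nonzero))))

  private
    1^n≈1 : ∀ n → 1# ^ n ≈ 1#
    1^n≈1 zero    = refl
    1^n≈1 (suc n) = trans (*-identityˡ _) (1^n≈1 n)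

    1≈-1⇒2≈0 : 1# ≈ - 1# → 2# ≈ 0#
    1≈-1⇒2≈0 1≈-1 = by-combination (solve 0 (κ 2 :- κ 0 := κ 1 :* (κ 1 :- :- κ 1)) refl) [ 1≈-1 ]

  wilson : ∏ nonzero ≈ - 1#
  wilson = trans (Reciprocal.∏-nonzero-square 1≉0 (*-identityˡ 1#)) (-‿cong (1^n≈1 (k ℕ.* 2)))
    where 1≉0 = λ 1≈0 → 0≉1 (sym 1≈0)

  euler-nonsquare : ∀ {n} → ¬ n ≈ 0# → ¬ IsSquare n → n ^ (k ℕ.* 2) ≈ - 1#
  euler-nonsquare n≉0 n-nonsquare = trans (sym (Reciprocal.∏-nonzero-nonsquare n≉0 n-nonsquare)) wilson

  -- Euler's criterion for -1: its exponent (q - 1)/2 = 2k is even.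
  -1-square : IsSquare (- 1#)
  -1-square = decidable-stable (square? (- 1#)) λ -1-nonsquare → 2≉0 (1≈-1⇒2≈0 (begin
    1#                    ≈⟨ 1^n≈1 k ⟨
    1# ^ k                ≈⟨ ^-congˡ k (solve 0 (κ 1 := :- κ 1 :* (:- κ 1 :* κ 1)) refl) ⟩
    ((- 1#) ^ 2) ^ k      ≈⟨ ^-assocʳ (- 1#) 2 k ⟩
    (- 1#) ^ (2 ℕ.* k)    ≡⟨ ≡.cong ((- 1#) ^_) (ℕ.*-comm 2 k) ⟩
    (- 1#) ^ (k ℕ.* 2)    ≈⟨ euler-nonsquare (λ -1≈0 → 0≉1 (sym (trans (sym (-‿involutive 1#)) (trans (-‿cong -1≈0) -0#≈0#)))) -1-nonsquare ⟩
    - 1#                  ∎))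

  nonsquare*nonsquare : ∀ {x y} → ¬ x ≈ 0# → ¬ y ≈ 0# → ¬ IsSquare x → ¬ IsSquare y → IsSquare (x * y)
  nonsquare*nonsquare {x} {y} x≉0 y≉0 x-nonsquare y-nonsquare =
    decidable-stable (square? (x * y)) λ xy-nonsquare → 2≉0 (1≈-1⇒2≈0 (begin
      1#                          ≈⟨ solve 0 (κ 1 := :- κ 1 :* :- κ 1) refl ⟩
      - 1# * - 1#                 ≈⟨ *-cong (euler-nonsquare x≉0 x-nonsquare) (euler-nonsquare y≉0 y-nonsquare) ⟨
      x ^ (k ℕ.* 2) * y ^ (k ℕ.* 2) ≈⟨ ^-distrib-* x y (k ℕ.* 2) ⟨
      (x * y) ^ (k ℕ.* 2)         ≈⟨ euler-nonsquare (x≉0∧y≉0⇒x*y≉0 x≉0 y≉0) xy-nonsquare ⟩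
      - 1#                        ∎))

-- F(√d) for a non-square d, with u + v√d represented by the pair (u , v).
module QuadraticExtension {c ℓ} (F : Field c ℓ) {d : Field.Carrier F}
                          (d-nonsquare : ¬ FieldProperties.IsSquare F d) where
  open Field F
  open FieldProperties F

  Element : Set c
  Element = Carrier × Carrier

  _≈ₑ_ : Element → Element → Set ℓ
  (u , v) ≈ₑ (u′ , v′) = u ≈ u′ × v ≈ v′

  _+ₑ_ _*ₑ_ : Element → Element → Element
  (u , v) +ₑ (u′ , v′) = u + u′ , v + v′
  (u , v) *ₑ (u′ , v′) = u * u′ + d * (v * v′) , u * v′ + v * u′

  -ₑ_ : Element → Element
  -ₑ (u , v) = - u , - v

  norm : Element → Carrier
  norm (u , v) = u * u - d * (v * v)

  _⁻¹ₑ : Element → Element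
  (u , v) ⁻¹ₑ = u * norm (u , v) ⁻¹ , - v * norm (u , v) ⁻¹

  norm≉0 : ∀ {p} → ¬ p ≈ₑ (0# , 0#) → ¬ norm p ≈ 0#
  norm≉0 {u , v} p≉0 norm≈0 with v ≟ 0#
  ... | yes v≈0 = p≉0 (x*x≈0⇒x≈0 (by-combination
          (solve 3 (λ u v d → u :* u :- κ 0 := κ 1 :* (u :* u :- d :* (v :* v) :- κ 0) :+ d :* v :* (v :- κ 0)) refl u v d)
          ([ norm≈0 ] ∷ʳ v≈0)) , v≈0)
  ... | no v≉0  = d-nonsquare (u * v ⁻¹ , by-combination
          (solve 4 (λ u v v⁻¹ d → (u :* v⁻¹) :* (u :* v⁻¹) :- d
                    := v⁻¹ :* v⁻¹ :* (u :* u :- d :* (v :* v) :- κ 0) :+ d :* (v :* v⁻¹ :+ κ 1) :* (v :* v⁻¹ :- κ 1))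
                    refl u v (v ⁻¹) d)
          ([ norm≈0 ] ∷ʳ ⁻¹-inverse v v≉0))

  field′ : Field c ℓ
  field′ = record
    { commutativeRing = record { isCommutativeRing = isCommutativeRingₑ }
    ; _⁻¹        = _⁻¹ₑ
    ; 0≉1        = 0≉1 ∘ proj₁
    ; ⁻¹-inverse = λ p p≉0 → inverse p (⁻¹-inverse (norm p) (norm≉0 p≉0))
    ; _≟_        = λ (u , v) (u′ , v′) → (u ≟ u′) ×-dec (v ≟ v′)
    }
    where
    inverse : ∀ p → norm p * norm p ⁻¹ ≈ 1# → (p *ₑ (p ⁻¹ₑ)) ≈ₑ (1# , 0#)
    inverse (u , v) n*n⁻¹≈1 =
      by-combination (solve 4 (λ u v d n⁻¹ → u :* (u :* n⁻¹) :+ d :* (v :* (:- v :* n⁻¹)) :- κ 1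
                                             := κ 1 :* ((u :* u :- d :* (v :* v)) :* n⁻¹ :- κ 1))
                       refl u v d (norm (u , v) ⁻¹))
                     [ n*n⁻¹≈1 ] ,
      solve 3 (λ u v n⁻¹ → u :* (:- v :* n⁻¹) :+ v :* (u :* n⁻¹) := κ 0) refl u v (norm (u , v) ⁻¹)
    isCommutativeRingₑ : IsCommutativeRing _≈ₑ_ _+ₑ_ _*ₑ_ -ₑ_ (0# , 0#) (1# , 0#)
    isCommutativeRingₑ = record
      { isRing = record
        { +-isAbelianGroup = record
          { isGroup = record
            { isMonoid = record
              { isSemigroup = record
                { isMagma = record
                  { isEquivalence = record
                    { refl  = refl , refl
                    ; sym   = λ (u≈ , v≈) → sym u≈ , sym v≈
                    ; trans = λ (u≈ , v≈) (u≈′ , v≈′) → trans u≈ u≈′ , trans v≈ v≈′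
                    }
                  ; ∙-cong = λ (u≈ , v≈) (u≈′ , v≈′) → +-cong u≈ u≈′ , +-cong v≈ v≈′
                  }
                ; assoc = λ _ _ _ → +-assoc _ _ _ , +-assoc _ _ _
                }
              ; identity = (λ _ → +-identityˡ _ , +-identityˡ _) , (λ _ → +-identityʳ _ , +-identityʳ _)
              }
            ; inverse = (λ _ → -‿inverseˡ _ , -‿inverseˡ _) , (λ _ → -‿inverseʳ _ , -‿inverseʳ _)
            ; ⁻¹-cong = λ (u≈ , v≈) → -‿cong u≈ , -‿cong v≈
            }
          ; comm = λ _ _ → +-comm _ _ , +-comm _ _
          }
        ; *-cong = λ (u≈ , v≈) (u≈′ , v≈′) →
            +-cong (*-cong u≈ u≈′) (*-congˡ (*-cong v≈ v≈′)) , +-cong (*-cong u≈ v≈′) (*-cong v≈ u≈′)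
        ; *-assoc = λ (u₁ , v₁) (u₂ , v₂) (u₃ , v₃) →
            solve 7 (λ u₁ v₁ u₂ v₂ u₃ v₃ d →
              (u₁ :* u₂ :+ d :* (v₁ :* v₂)) :* u₃ :+ d :* ((u₁ :* v₂ :+ v₁ :* u₂) :* v₃)
              := u₁ :* (u₂ :* u₃ :+ d :* (v₂ :* v₃)) :+ d :* (v₁ :* (u₂ :* v₃ :+ v₂ :* u₃))) refl u₁ v₁ u₂ v₂ u₃ v₃ d ,
            solve 7 (λ u₁ v₁ u₂ v₂ u₃ v₃ d →
              (u₁ :* u₂ :+ d :* (v₁ :* v₂)) :* v₃ :+ (u₁ :* v₂ :+ v₁ :* u₂) :* u₃
              := u₁ :* (u₂ :* v₃ :+ v₂ :* u₃) :+ v₁ :* (u₂ :* u₃ :+ d :* (v₂ :* v₃))) refl u₁ v₁ u₂ v₂ u₃ v₃ d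
        ; *-identity =
            (λ (u , v) → solve 3 (λ u v d → κ 1 :* u :+ d :* (κ 0 :* v) := u) refl u v d ,
                         solve 2 (λ u v → κ 1 :* v :+ κ 0 :* u := v) refl u v) ,
            (λ (u , v) → solve 3 (λ u v d → u :* κ 1 :+ d :* (v :* κ 0) := u) refl u v d ,
                         solve 2 (λ u v → u :* κ 0 :+ v :* κ 1 := v) refl u v)
        ; distrib =
            (λ (u₁ , v₁) (u₂ , v₂) (u₃ , v₃) →
              solve 7 (λ u₁ v₁ u₂ v₂ u₃ v₃ d → u₁ :* (u₂ :+ u₃) :+ d :* (v₁ :* (v₂ :+ v₃))
                := (u₁ :* u₂ :+ d :* (v₁ :* v₂)) :+ (u₁ :* u₃ :+ d :* (v₁ :* v₃))) refl u₁ v₁ u₂ v₂ u₃ v₃ d ,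
              solve 6 (λ u₁ v₁ u₂ v₂ u₃ v₃ → u₁ :* (v₂ :+ v₃) :+ v₁ :* (u₂ :+ u₃)
                := (u₁ :* v₂ :+ v₁ :* u₂) :+ (u₁ :* v₃ :+ v₁ :* u₃)) refl u₁ v₁ u₂ v₂ u₃ v₃) ,
            (λ (u₁ , v₁) (u₂ , v₂) (u₃ , v₃) →
              solve 7 (λ u₁ v₁ u₂ v₂ u₃ v₃ d → (u₂ :+ u₃) :* u₁ :+ d :* ((v₂ :+ v₃) :* v₁)
                := (u₂ :* u₁ :+ d :* (v₂ :* v₁)) :+ (u₃ :* u₁ :+ d :* (v₃ :* v₁))) refl u₁ v₁ u₂ v₂ u₃ v₃ d ,
              solve 6 (λ u₁ v₁ u₂ v₂ u₃ v₃ → (u₂ :+ u₃) :* v₁ :+ (v₂ :+ v₃) :* u₁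
                := (u₂ :* v₁ :+ v₂ :* u₁) :+ (u₃ :* v₁ :+ v₃ :* u₁)) refl u₁ v₁ u₂ v₂ u₃ v₃)
        }
      ; *-comm = λ (u₁ , v₁) (u₂ , v₂) →
          solve 5 (λ u₁ v₁ u₂ v₂ d → u₁ :* u₂ :+ d :* (v₁ :* v₂) := u₂ :* u₁ :+ d :* (v₂ :* v₁)) refl u₁ v₁ u₂ v₂ d ,
          solve 4 (λ u₁ v₁ u₂ v₂ → u₁ :* v₂ :+ v₁ :* u₂ := u₂ :* v₁ :+ v₂ :* u₁) refl u₁ v₁ u₂ v₂
      }

  embed : Carrier → Element
  embed u = u , 0#

  embed-hom : IsFieldHom F field′ embed
  embed-hom = record
    { isSemiringHomomorphism = record
      { isNearSemiringHomomorphism = record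
        { +-isMonoidHomomorphism = record
          { isMagmaHomomorphism = record
            { isRelHomomorphism = record { cong = λ u≈u′ → u≈u′ , refl }
            ; homo = λ _ _ → refl , sym (+-identityʳ 0#)
            }
          ; ε-homo = refl , refl
          }
        ; *-homo = λ u u′ → solve 3 (λ u u′ d → u :* u′ := u :* u′ :+ d :* (κ 0 :* κ 0)) refl u u′ d ,
                            solve 2 (λ u u′ → κ 0 := u :* κ 0 :+ κ 0 :* u′) refl u u′
        }
      ; 1#-homo = refl , refl
      }
    ; -‿homo = λ _ → refl , sym -0#≈0#
    }

  √d : Element
  √d = 0# , 1#

  √d*√d≈d : (√d *ₑ √d) ≈ₑ embed d
  √d*√d≈d = solve 1 (λ d → κ 0 :* κ 0 :+ d :* (κ 1 :* κ 1) := d) refl d ,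
            solve 0 (κ 0 :* κ 1 :+ κ 1 :* κ 0 := κ 0) refl

module ParentsAndChildren {c ℓ} (F : Field c ℓ) (2≉0 : ¬ Field._≈_ F (Field.2# F) (Field.0# F)) where
  open Field F
  open FieldProperties F
  open Aquarium F

  square-resp : ∀ {x y} → x ≈ y → IsSquare x → IsSquare y
  square-resp x≈y (r , r²≈x) = r , trans r²≈x x≈y

  square*square : ∀ {x y} → IsSquare x → IsSquare y → IsSquare (x * y)
  square*square (r , r²≈x) (s , s²≈y) =
    r * s , trans (solve 2 (λ r s → (r :* s) :* (r :* s) := (r :* r) :* (s :* s)) refl r s) (*-cong r²≈x s²≈y)

  private
    2*½≈1 : 2# * 2# ⁻¹ ≈ 1#
    2*½≈1 = ⁻¹-inverse 2# 2≉0

  -- (a₀, b₀) → (a, b) forces a² - b² = ((a₀ - b₀)/2)².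
  parent⇒square : ∀ {a b} → HasParent a b → IsSquare (a * a - b * b)
  parent⇒square {a} {b} (a₀ , b₀ , _ , _ , s , s²≈a₀b₀ , a≈avg , b≈±s) =
    (a₀ - b₀) / 2# , by-combination
      (solve 6 (λ a b s a₀ b₀ h → ((a₀ :- b₀) :* h) :* ((a₀ :- b₀) :* h) :- (a :* a :- b :* b)
                := κ 1 :* (b :* b :- s :* s) :+ κ 1 :* (s :* s :- a₀ :* b₀)
                   :+ :- (a :+ (a₀ :+ b₀) :* h) :* (a :- (a₀ :+ b₀) :* h)
                   :+ :- (a₀ :* b₀ :* (κ 2 :* h :+ κ 1)) :* (κ 2 :* h :- κ 1)) refl a b s a₀ b₀ (2# ⁻¹))
      ([ b²≈s² b≈±s ] ∷ʳ s²≈a₀b₀ ∷ʳ a≈avg ∷ʳ 2*½≈1)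
    where
    b²≈s² : b ≈ s ⊎ b ≈ - s → b * b ≈ s * s
    b²≈s² (inj₁ b≈s)  = *-cong b≈s b≈s
    b²≈s² (inj₂ b≈-s) = trans (*-cong b≈-s b≈-s) (-x*-x≈x*x s)

  -- Conversely the parent is (a + c, a - c) for c² = a² - b².
  square⇒parent : ∀ {a b} → InV a b → IsSquare (a * a - b * b) → HasParent a b
  square⇒parent {a} {b} ab∈V@(a≉0 , b≉0 , a≉b , a≉-b) (c , c²≈a²-b²) =
    a + c , a - c , (a+c≉0 , a-c≉0 , a+c≉a-c , a+c≉-[a-c]) , ab∈V , b , b²≈[a+c][a-c] , a≈avg , inj₁ refl
    where
    b²≈[a+c][a-c] : b * b ≈ (a + c) * (a - c)
    b²≈[a+c][a-c] = by-combination
      (solve 3 (λ a b c → b :* b :- (a :+ c) :* (a :- c) := κ 1 :* (c :* c :- (a :* a :- b :* b))) refl a b c)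
      [ c²≈a²-b² ]
    a≈avg : a ≈ ((a + c) + (a - c)) / 2#
    a≈avg = by-combination
      (solve 3 (λ a c h → a :- ((a :+ c) :+ (a :- c)) :* h := :- a :* (κ 2 :* h :- κ 1)) refl a c (2# ⁻¹))
      [ 2*½≈1 ]
    a+c≉0 : ¬ a + c ≈ 0#
    a+c≉0 a+c≈0 = b≉0 (x*x≈0⇒x≈0 (by-combination
      (solve 3 (λ a b c → b :* b :- κ 0 := (a :- c) :* ((a :+ c) :- κ 0) :+ κ 1 :* (c :* c :- (a :* a :- b :* b)))
        refl a b c)
      ([ a+c≈0 ] ∷ʳ c²≈a²-b²)))
    a-c≉0 : ¬ a - c ≈ 0#
    a-c≉0 a-c≈0 = b≉0 (x*x≈0⇒x≈0 (by-combination
      (solve 3 (λ a b c → b :* b :- κ 0 := (a :+ c) :* ((a :- c) :- κ 0) :+ κ 1 :* (c :* c :- (a :* a :- b :* b)))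
        refl a b c)
      ([ a-c≈0 ] ∷ʳ c²≈a²-b²)))
    a+c≉a-c : ¬ a + c ≈ a - c
    a+c≉a-c a+c≈a-c = [ a≉b , a≉-b ]′ (x*x≈y*y⇒x≈±y a²≈b²)
      where
      c≈0 : c ≈ 0#
      c≈0 = x≈-x⇒x≈0 2≉0 (by-combination
        (solve 2 (λ a c → c :- :- c := κ 1 :* ((a :+ c) :- (a :- c))) refl a c) [ a+c≈a-c ])
      a²≈b² : a * a ≈ b * b
      a²≈b² = by-combination
        (solve 3 (λ a b c → a :* a :- b :* b := c :* (c :- κ 0) :+ :- κ 1 :* (c :* c :- (a :* a :- b :* b))) refl a b c)
        ([ c≈0 ] ∷ʳ c²≈a²-b²)
    a+c≉-[a-c] : ¬ a + c ≈ - (a - c)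
    a+c≉-[a-c] a+c≈-[a-c] = a≉0 (x≈-x⇒x≈0 2≉0 (by-combination
      (solve 2 (λ a c → a :- :- a := κ 1 :* ((a :+ c) :- :- (a :- c))) refl a c) [ a+c≈-[a-c] ]))

  -- A child of (a, b) is ((a + b)/2, ± √(ab)); it is in V because a ≠ b.
  square⇒child : ∀ {a b} → InV a b → IsSquare (a * b) → HasChild a b
  square⇒child {a} {b} ab∈V@(a≉0 , b≉0 , a≉b , a≉-b) (s , s²≈ab) =
    (a + b) / 2# , s , ab∈V , (a₁≉0 , s≉0 , a₁≉±s ∘ inj₁ , a₁≉±s ∘ inj₂) , s , s²≈ab , refl , inj₁ refl
    where
    a₁ = (a + b) / 2#
    a₁≉0 : ¬ a₁ ≈ 0#
    a₁≉0 a₁≈0 with x*y≈0⇒x≈0⊎y≈0 a₁≈0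
    ... | inj₁ a+b≈0 = a≉-b (by-combination (solve 2 (λ a b → a :- :- b := κ 1 :* ((a :+ b) :- κ 0)) refl a b) [ a+b≈0 ])
    ... | inj₂ ½≈0   = 0≉1 (trans (sym (zeroʳ 2#)) (trans (*-congˡ (sym ½≈0)) 2*½≈1))
    s≉0 : ¬ s ≈ 0#
    s≉0 s≈0 = x≉0∧y≉0⇒x*y≉0 a≉0 b≉0 (trans (sym s²≈ab) (trans (*-congʳ s≈0) (zeroˡ s)))
    a₁≉±s : a₁ ≈ s ⊎ a₁ ≈ - s → ⊥
    a₁≉±s a₁≈±s = a≉b (x-y≈0⇒x≈y _ _ (x*x≈0⇒x≈0 (by-combination
      (solve 3 (λ a b h → (a :- b) :* (a :- b) :- κ 0
                := κ 4 :* (((a :+ b) :* h) :* ((a :+ b) :* h) :- a :* b)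
                   :+ :- ((a :+ b) :* (a :+ b) :* (κ 2 :* h :+ κ 1)) :* (κ 2 :* h :- κ 1)) refl a b (2# ⁻¹))
      ([ a₁²≈ab a₁≈±s ] ∷ʳ 2*½≈1))))
      where
      a₁²≈ab : a₁ ≈ s ⊎ a₁ ≈ - s → a₁ * a₁ ≈ a * b
      a₁²≈ab (inj₁ a₁≈s)  = trans (*-cong a₁≈s a₁≈s) s²≈ab
      a₁²≈ab (inj₂ a₁≈-s) = trans (*-cong a₁≈-s a₁≈-s) (trans (-x*-x≈x*x s) s²≈ab)

  child⇒square : ∀ {a b} → HasChild a b → IsSquare (a * b)
  child⇒square (_ , _ , _ , _ , s , s²≈ab , _) = s , s²≈ab

module FourTorsion {c ℓ} (F : Field c ℓ) (2≉0 : ¬ Field._≈_ F (Field.2# F) (Field.0# F)) {l : Field.Carrier F} where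
  open Field F
  open FieldProperties F using (IsSquare; -0#≈0#)
  open LegendreCurve F l using (RationalHalves)

  rational-halves⇒full-four-torsion : RationalHalves 0# l → RationalHalves 1# (1# - l) → RationalHalves l (l * (l - 1#)) →
                                      FullFourTorsion F l
  rational-halves⇒full-four-torsion over-0 over-1 over-l L ι ι-hom =
    Embedding.lift-four-torsion F L ι ι-hom l 2≉0 over-0 over-1 over-l

  -- Over F(√(1 - l)) the point with x = 1 + √(1 - l) has order 4 but is not F-rational.
  full-four-torsion⇒square : ¬ l ≈ 0# → ¬ l ≈ 1# → FullFourTorsion F l → ¬ ¬ IsSquare (1# - l)
  full-four-torsion⇒square l≉0 l≉1 full-four-torsion 1-l-nonsquare =
    not-rational (full-four-torsion field′ embed embed-hom H (proj₁ order-four) (proj₂ order-four))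
    where
    open QuadraticExtension F 1-l-nonsquare
    module L  = Field field′
    open FieldProperties field′ using (solve; κ; _:+_; _:*_; _:=_)
    open LegendreCurve field′ (embed l) using (half; order-four-point)
    H = half L.1# L.0# √d
    order-four = order-four-point (2≉0 ∘ proj₁) (l≉0 ∘ proj₁) (l≉1 ∘ proj₁)
                   (proj₁ √d*√d≈d , trans (proj₂ √d*√d≈d) (sym (trans (+-identityˡ _) -0#≈0#)))
    x≈1+√d : (L.1# L.* L.1# L.+ L.1# L.* L.0# L.+ L.1# L.* √d L.+ L.0# L.* √d) L.≈ (L.1# L.+ √d)
    x≈1+√d = solve 1 (λ g → κ 1 :* κ 1 :+ κ 1 :* κ 0 :+ κ 1 :* g :+ κ 0 :* g := κ 1 :+ g) L.refl √d
    not-rational : ¬ (Σ (Pt Carrier) λ Q → Legendre.OnCurve F l Q × Legendre._≈P_ field′ (embed l) (mapPt embed Q) H)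
    not-rational (∞ , _ , lift ())
    not-rational (⟨ u , v ⟩ , _ , ιu≈x , _) = 0≉1 (trans (proj₂ (L.trans ιu≈x x≈1+√d)) (+-identityˡ 1#))

module Lemma6p13 {c ℓ} (F : Field c ℓ) {q : ℕ} (card : HasCardinality F q) (q≡1[4] : q % 4 ≡ 1)
                 {a b : Field.Carrier F} (ab∈V : Aquarium.InV F a b) where
  open Field F
  open FieldProperties F
  open FiniteField F card q≡1[4] using (2≉0; square?; -1-square; nonsquare*nonsquare)
  open ParentsAndChildren F 2≉0
  open Aquarium F using (HasParent; HasChild)
  open Legendre F
  open LegendreCurve F
  open FourTorsion F 2≉0

  private
    a≉0 = proj₁ ab∈V
    b≉0 = proj₁ (proj₂ ab∈V)
    a≉b = proj₁ (proj₂ (proj₂ ab∈V))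
    a≉-b = proj₂ (proj₂ (proj₂ ab∈V))
    a*a⁻¹≈1 = ⁻¹-inverse a a≉0
    i = proj₁ -1-square
    i²≈-1 = proj₂ -1-square

  l t : Carrier
  l = (b * b) / (a * a)
  t = b * a ⁻¹

  t*t≈l : t * t ≈ l
  t*t≈l = sym (by-combination
    (solve 4 (λ a b a⁻¹ A → b :* b :* A :- (b :* a⁻¹) :* (b :* a⁻¹)
              := :- (b :* b :* A :* (a :* a⁻¹ :+ κ 1)) :* (a :* a⁻¹ :- κ 1) :+ b :* b :* a⁻¹ :* a⁻¹ :* (a :* a :* A :- κ 1))
      refl a b (a ⁻¹) ((a * a) ⁻¹))
    ([ a*a⁻¹≈1 ] ∷ʳ ⁻¹-inverse (a * a) (x≉0∧y≉0⇒x*y≉0 a≉0 a≉0)))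

  t≉1 : ¬ t ≈ 1#
  t≉1 t≈1 = a≉b (sym (by-combination
    (solve 3 (λ a b a⁻¹ → b :- a := :- b :* (a :* a⁻¹ :- κ 1) :+ a :* (b :* a⁻¹ :- κ 1)) refl a b (a ⁻¹))
    ([ a*a⁻¹≈1 ] ∷ʳ t≈1)))

  t≉-1 : ¬ t ≈ - 1#
  t≉-1 t≈-1 = a≉-b (by-combination
    (solve 3 (λ a b a⁻¹ → a :- :- b := :- b :* (a :* a⁻¹ :- κ 1) :+ a :* (b :* a⁻¹ :- :- κ 1)) refl a b (a ⁻¹))
    ([ a*a⁻¹≈1 ] ∷ʳ t≈-1))

  l≉0 : ¬ l ≈ 0#
  l≉0 l≈0 = b≉0 (by-combination
    (solve 3 (λ a b a⁻¹ → b :- κ 0 := :- b :* (a :* a⁻¹ :- κ 1) :+ a :* (b :* a⁻¹ :- κ 0)) refl a b (a ⁻¹))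
    ([ a*a⁻¹≈1 ] ∷ʳ x*x≈0⇒x≈0 (trans t*t≈l l≈0)))

  l≉1 : ¬ l ≈ 1#
  l≉1 l≈1 = [ t≉1 , t≉-1 ]′ (x*x≈y*y⇒x≈±y (trans t*t≈l (trans l≈1 (sym (*-identityˡ 1#)))))

  parent⇔square : (HasParent a b → IsSquare (1# - l)) × (IsSquare (1# - l) → HasParent a b)
  parent⇔square =
    (λ parent → square-resp 1-l≈[a²-b²]a⁻² (square*square (parent⇒square parent) (a ⁻¹ , refl))) ,
    (λ square → square⇒parent ab∈V (square-resp a²-b²≈[1-l]a² (square*square square (a , refl))))
    where
    1-l≈[a²-b²]a⁻² : (a * a - b * b) * (a ⁻¹ * a ⁻¹) ≈ 1# - l
    1-l≈[a²-b²]a⁻² = trans (by-combination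
      (solve 3 (λ a b a⁻¹ → (a :* a :- b :* b) :* (a⁻¹ :* a⁻¹) :- (κ 1 :- (b :* a⁻¹) :* (b :* a⁻¹))
                := (a :* a⁻¹ :+ κ 1) :* (a :* a⁻¹ :- κ 1)) refl a b (a ⁻¹))
      [ a*a⁻¹≈1 ]) (x-a-cong t*t≈l)
    a²-b²≈[1-l]a² : (1# - l) * (a * a) ≈ a * a - b * b
    a²-b²≈[1-l]a² = trans (*-congʳ (x-a-cong (sym t*t≈l))) (by-combination
      (solve 3 (λ a b a⁻¹ → (κ 1 :- (b :* a⁻¹) :* (b :* a⁻¹)) :* (a :* a) :- (a :* a :- b :* b)
                := :- (b :* b :* (a :* a⁻¹ :+ κ 1)) :* (a :* a⁻¹ :- κ 1)) refl a b (a ⁻¹))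
      [ a*a⁻¹≈1 ])

  child⇔square : (HasChild a b → IsSquare t) × (IsSquare t → HasChild a b)
  child⇔square =
    (λ child → square-resp t≈ab/a² (square*square (child⇒square child) (a ⁻¹ , refl))) ,
    (λ square → square⇒child ab∈V (square-resp ab≈t*a² (square*square square (a , refl))))
    where
    t≈ab/a² : (a * b) * (a ⁻¹ * a ⁻¹) ≈ t
    t≈ab/a² = by-combination
      (solve 3 (λ a b a⁻¹ → (a :* b) :* (a⁻¹ :* a⁻¹) :- b :* a⁻¹ := b :* a⁻¹ :* (a :* a⁻¹ :- κ 1)) refl a b (a ⁻¹))
      [ a*a⁻¹≈1 ]
    ab≈t*a² : t * (a * a) ≈ a * b
    ab≈t*a² = by-combination
      (solve 3 (λ a b a⁻¹ → (b :* a⁻¹) :* (a :* a) :- a :* b := a :* b :* (a :* a⁻¹ :- κ 1)) refl a b (a ⁻¹))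
      [ a*a⁻¹≈1 ]

  parent⇒full-four-torsion : HasParent a b → FullFourTorsion F l
  parent⇒full-four-torsion parent =
    let _ , c²≈1-l = proj₁ parent⇔square parent
        over-0 , over-1 , over-l = rational-halves l t*t≈l c²≈1-l i²≈-1
    in rational-halves⇒full-four-torsion over-0 over-1 over-l

  full-four-torsion⇒parent : FullFourTorsion F l → HasParent a b
  full-four-torsion⇒parent full = proj₂ parent⇔square
    (decidable-stable (square? (1# - l)) (full-four-torsion⇒square l≉0 l≉1 full))

  -- 4R = (0, 0) makes l = w⁴, so t = ± w² is a square because -1 is.
  origin⇒child : Origin∈4E l → HasChild a b
  origin⇒child (∞ , _ , lift ())
  origin⇒child (⟨ x , y ⟩ , y²≈fx , 4R≈O) =
    let w , w⁴≈l = four-times≈origin⇒fourth-power l 2≉0 y²≈fx 4R≈O in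
    proj₂ child⇔square ([ (λ w²≈t → w , w²≈t) , (λ w²≈-t → i * w , by-combination
      (solve 3 (λ i w t → (i :* w) :* (i :* w) :- t := w :* w :* (i :* i :- :- κ 1) :+ :- κ 1 :* (w :* w :- :- t))
        refl i w t)
      ([ i²≈-1 ] ∷ʳ w²≈-t)) ]′ (x*x≈y*y⇒x≈±y (trans w⁴≈l (sym t*t≈l))))

  -- Without a parent 1 - l = -(t - 1)(t + 1) is not a square, so t - 1 or t + 1 is;
  -- either gives a quarter of (0, 0) (for t or for -t).
  child⇒origin : ¬ HasParent a b → HasChild a b → Origin∈4E l
  child⇒origin no-parent child = by-cases (square? (t - 1#)) (square? (t + 1#))
    where
    u = proj₁ (proj₁ child⇔square child)
    u²≈t = proj₂ (proj₁ child⇔square child)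
    t-1≉0 : ¬ t - 1# ≈ 0#
    t-1≉0 = t≉1 ∘ x-y≈0⇒x≈y _ _
    t+1≉0 : ¬ t + 1# ≈ 0#
    t+1≉0 t+1≈0 = t≉-1 (by-combination (solve 1 (λ t → t :- :- κ 1 := κ 1 :* ((t :+ κ 1) :- κ 0)) refl t) [ t+1≈0 ])
    -[t-1][t+1]≈1-l : - 1# * ((t - 1#) * (t + 1#)) ≈ 1# - l
    -[t-1][t+1]≈1-l = by-combination
      (solve 2 (λ t l → :- κ 1 :* ((t :- κ 1) :* (t :+ κ 1)) :- (κ 1 :- l) := :- κ 1 :* (t :* t :- l)) refl t l)
      [ t*t≈l ]
    by-cases : Dec (IsSquare (t - 1#)) → Dec (IsSquare (t + 1#)) → Origin∈4E l
    by-cases (yes (v , v²≈t-1)) _ = quarter-of-origin l 2≉0 l≉0 l≉1 t*t≈l u²≈t v²≈t-1 i²≈-1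
    by-cases (no _) (yes (w , w²≈t+1)) = quarter-of-origin l 2≉0 l≉0 l≉1
      (trans (-x*-x≈x*x t) t*t≈l)
      (by-combination (solve 3 (λ i u t → (i :* u) :* (i :* u) :- :- t := u :* u :* (i :* i :- :- κ 1) :+ :- κ 1 :* (u :* u :- t))
                         refl i u t) ([ i²≈-1 ] ∷ʳ u²≈t))
      (by-combination (solve 3 (λ i w t → (i :* w) :* (i :* w) :- (:- t :- κ 1)
                                 := w :* w :* (i :* i :- :- κ 1) :+ :- κ 1 :* (w :* w :- (t :+ κ 1))) refl i w t)
                      ([ i²≈-1 ] ∷ʳ w²≈t+1))
      i²≈-1
    by-cases (no t-1-nonsquare) (no t+1-nonsquare) = contradiction
      (square-resp -[t-1][t+1]≈1-l (square*square -1-square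
        (nonsquare*nonsquare t-1≉0 t+1≉0 t-1-nonsquare t+1-nonsquare)))
      (no-parent ∘ proj₂ parent⇔square)

lemma6p13 : (F : Field 0ℓ 0ℓ) (q : ℕ) → IsPrimePower q → q % 4 ≡ 1 → HasCardinality F q →
    (a b : Field.Carrier F) → Aquarium.InV F a b →
    let l = Field._/_ F (Field._*_ F b b) (Field._*_ F a a) in
    (Aquarium.HasParent F a b ⇔ FullFourTorsion F l) ×
    (¬ Aquarium.HasParent F a b → (Legendre.Origin∈4E F l ⇔ Aquarium.HasChild F a b))
-- Only |F| ≡ 1 (mod 4) is used.
lemma6p13 F q _ q≡1[4] card a b ab∈V =
  mk⇔ parent⇒full-four-torsion full-four-torsion⇒parent ,
  λ no-parent → mk⇔ origin⇒child (child⇒origin no-parent)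
  where open Lemma6p13 F card q≡1[4] ab∈V
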